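{- Let $n \geq 1$ and $k \geq 3$ be integers and let $T_{n,k}$ be the dendrimer. For every integer $\ell$ with $1 \leq \ell \leq 2n$, the number $n_{\ell}(T_{n,k})$ of paths of length $\ell$ in $T_{n,k}$ is $$n_{\ell}(T_{n, k}) = \begin{cases} \dfrac{k(k-1)^{\ell-1}}{2} \cdot \dfrac{k(k-1)^{n-\frac{\ell}{2}}-2}{k-2} & \text{if } \ell \text{ is even},\\[12pt] k(k-1)^{\frac{\ell-1}{2}}\cdot\dfrac{(k-1)^{n}-(k-1)^{\frac{\ell-1}{2}}}{k-2} & \text{if } \ell \text{ is odd.}\end{cases}$$
   Context: For integers $n \geq 1$ and $k \geq 2$, the dendrimer $T_{n,k}$ is the rooted tree with a root $r$ such that every vertex at distance less than $n$ from $r$ has degree exactly $k$ and every vertex at distance exactly $n$ from $r$ is a leaf (so $T_{n,k}$ has radius $n$, diameter $2n$, and all leaves at distance $n$ from $r$). A path of length $\ell$ is a path with $\ell$ edges, counted as a subgraph (i.e. a path and its reversal are the same path). For a graph $G$, $n_{\ell}(G)$ denotes the number of paths of length $\ell$ in $G$. -}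

module Defs where

open import Data.Nat using (ℕ; zero; suc; _+_; _*_; _∸_; _/_)
open import Data.Nat.Properties using (_≟_)
open import Data.Bool using (Bool; true; false; _∧_; _∨_; not; if_then_else_)
open import Data.List using (List; []; _∷_; map; concatMap; length; filterᵇ; upTo)
open import Data.List.Properties as LP using ()
open import Relation.Nullary.Decidable using (does)
open import Relation.Binary.PropositionalEquality using (_≡_)

-- Vertices of the dendrimer T_{n,k} are encoded by their "address" from the
-- root r, written child-first: the root is [], and the children of a vertex
-- with address u are the addresses c ∷ u.  The root has k children
-- (c ∈ {0,…,k-1}); every other non-leaf vertex has k-1 children
-- (c ∈ {0,…,k-2}), so together with its parent it has degree k.
-- Vertices at depth n are leaves.

Vertex : Set
Vertex = List ℕ

level : ℕ → ℕ → List Vertex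
level k zero = [] ∷ []
level k (suc zero) = map (λ c → c ∷ []) (upTo k)
level k (suc (suc d)) = concatMap (λ u → map (λ c → c ∷ u) (upTo (k ∸ 1))) (level k (suc d))

vertices : ℕ → ℕ → List Vertex
vertices zero k = level k zero
vertices (suc n) k = Data.List._++_ (vertices n k) (level k (suc n))

_==ᵥ_ : Vertex → Vertex → Bool
u ==ᵥ v = does (LP.≡-dec _≟_ u v)

childOf : Vertex → Vertex → Bool
childOf u [] = false
childOf u (c ∷ w) = w ==ᵥ u

adjacent : Vertex → Vertex → Bool
adjacent u v = childOf u v ∨ childOf v u

sequences : {A : Set} → ℕ → List A → List (List A)
sequences zero xs = [] ∷ []
sequences (suc m) xs = concatMap (λ s → map (λ x → x ∷ s) xs) (sequences m xs)

notIn : Vertex → List Vertex → Bool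
notIn v [] = true
notIn v (w ∷ ws) = not (v ==ᵥ w) ∧ notIn v ws

allDistinct : List Vertex → Bool
allDistinct [] = true
allDistinct (v ∷ vs) = notIn v vs ∧ allDistinct vs

consecutiveAdjacent : List Vertex → Bool
consecutiveAdjacent [] = true
consecutiveAdjacent (v ∷ []) = true
consecutiveAdjacent (v ∷ w ∷ vs) = adjacent v w ∧ consecutiveAdjacent (w ∷ vs)

isOrientedPath : List Vertex → Bool
isOrientedPath p = allDistinct p ∧ consecutiveAdjacent p

orientedPaths : ℕ → ℕ → ℕ → ℕ
orientedPaths n k ℓ =
  length (filterᵇ isOrientedPath (sequences (suc ℓ) (vertices n k)))

-- n_ℓ(T_{n,k}): paths counted as subgraphs, i.e. a path and its reversal are
-- identified.  For ℓ ≥ 1 every path has exactly two orientations.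
numPaths : ℕ → ℕ → ℕ → ℕ
numPaths n k ℓ = orientedPaths n k ℓ / 2

module Submission where

-- Paths are enumerated by growing them at their head.  In a tree, a path with head h extends
-- by every neighbour of h except the vertex it arrived from, so the number of oriented paths of
-- length ℓ is Σ_v w(ℓ, v), where w(ℓ, v) counts non-backtracking walks of length ℓ from v; in
-- T_{n,k} it depends only on the depth of v and the direction of the last step.  With q = k − 1,
-- comparing T_{n+1,k} with T_{n,k} moved one level down gives N_{n+1}(r+1) = q·N_n(r+1) + 2k·q^r
-- for r ≤ 2n, where N_n(ℓ) = 2·n_ℓ(T_{n,k}) (total n ℓ below).  Starting from N_m(2m+1) = 0 and
-- N_{m+1}(2m+2) = k·q^{2m+1} (leaf-to-leaf paths through the root), this gives
-- N_n(2m+1) = 2k·q^{2m}·(1 + q + ⋯ + q^{n−m−1}) and an analogous even formula, and multiplying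
-- by k − 2 = q − 1 sums the geometric series.

open import Algebra.Bundles using (CommutativeMonoid)
open import Data.Bool using (Bool; true; false; _∧_; _∨_; not; if_then_else_; T; T?)
open import Data.Bool.Properties using (∧-identityʳ; ∧-zeroʳ; ∨-identityʳ; T-≡; ¬-not; ∧-commutativeMonoid)
open import Data.Empty using (⊥; ⊥-elim)
open import Data.List using (List; []; _∷_; _++_; map; concatMap; length; filterᵇ; upTo)
open import Data.List.Properties
  using (filter-++; filter-none; length-++-≤ʳ; ++-assoc; applyUpTo-∷ʳ; length-upTo; length-map; ∷-injectiveʳ; ≡-dec)
open import Data.List.Relation.Unary.All as All using (All; []; _∷_)
open import Data.List.Relation.Unary.All.Properties using (applyUpTo⁺₁; ++⁺; concat⁺; map⁺)
open import Data.Nat using (ℕ; zero; suc; pred; _+_; _*_; _∸_; _^_; _/_; _≤_; _<_; _>_; s≤s; z≤n; _≡ᵇ_; _<ᵇ_)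
open import Data.Nat.DivMod using (m*n/n≡m)
open import Data.Nat.Properties
open import Data.Nat.Tactic.RingSolver using (solve-∀)
open import Data.Product using (_×_; _,_; ∃; proj₁; proj₂)
open import Data.Sum using (_⊎_; inj₁; inj₂)
open import Data.Unit using (⊤; tt)
open import Function using (_∘_; Equivalence)
open import Relation.Binary using (Tri; tri<; tri≈; tri>)
open import Relation.Nullary using (¬_; Dec; yes; no)
open import Relation.Nullary.Decidable using (dec-true; dec-false)
open import Relation.Binary.PropositionalEquality
open import Algebra.Properties.CommutativeSemigroup +-commutativeSemigroup
  using () renaming (interchange to +-interchange)
open import Algebra.Properties.CommutativeSemigroup (CommutativeMonoid.commutativeSemigroup ∧-commutativeMonoid)
  using () renaming (interchange to ∧-interchange)

open import Defs

private variable
  A B : Set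

∧-true : ∀ {a b} → (a ∧ b) ≡ true → a ≡ true × b ≡ true
∧-true {true} {true} e = refl , refl

∧-implied : (a b : Bool) → (a ≡ true → b ≡ true) → a ∧ b ≡ a
∧-implied true  b a⇒b = a⇒b refl
∧-implied false b _   = refl

if-∧-∨ : (a b c : Bool) {x y z : ℕ} →
  (b ≡ true → x ≡ y) → (c ≡ true → x ≡ z) → (b ≡ true → c ≡ false) →
  (if a ∧ (c ∨ b) then x else 0) ≡ (if b ∧ a then y else 0) + (if c ∧ a then z else 0)
if-∧-∨ false true  true  _   _   _     = refl
if-∧-∨ false true  false _   _   _     = refl
if-∧-∨ false false true  _   _   _     = refl
if-∧-∨ false false false _   _   _     = refl
if-∧-∨ true  true  c     x=y _   ¬c with refl ← ¬c refl = trans (x=y refl) (sym (+-identityʳ _))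
if-∧-∨ true  false true  _   x=z _     = x=z refl
if-∧-∨ true  false false _   _   _     = refl

≡ᵇ-true : ∀ {a b} → a ≡ b → (a ≡ᵇ b) ≡ true
≡ᵇ-true {a} {b} a≡b = Equivalence.to T-≡ (≡⇒≡ᵇ a b a≡b)

≡ᵇ-false : ∀ {a b} → a ≢ b → (a ≡ᵇ b) ≡ false
≡ᵇ-false {a} {b} a≢b = ¬-not (λ e → a≢b (≡ᵇ⇒≡ a b (Equivalence.from T-≡ e)))

≡ᵇ-sym : ∀ a b → (a ≡ᵇ b) ≡ (b ≡ᵇ a)
≡ᵇ-sym zero    zero    = refl
≡ᵇ-sym zero    (suc b) = refl
≡ᵇ-sym (suc a) zero    = refl
≡ᵇ-sym (suc a) (suc b) = ≡ᵇ-sym a b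

<ᵇ-true : ∀ {a b} → a < b → (a <ᵇ b) ≡ true
<ᵇ-true a<b = Equivalence.to T-≡ (<⇒<ᵇ a<b)

<ᵇ-false : ∀ {a b} → b ≤ a → (a <ᵇ b) ≡ false
<ᵇ-false {a} {b} b≤a = ¬-not (λ e → <⇒≱ (<ᵇ⇒< a b (Equivalence.from T-≡ e)) b≤a)

if-<ᵇ-suc : (x a b : ℕ) →
  (if a <ᵇ suc b then x else 0) ≡ (if a <ᵇ b then x else 0) + (if a ≡ᵇ b then x else 0)
if-<ᵇ-suc x zero    zero    = refl
if-<ᵇ-suc x zero    (suc b) = sym (+-identityʳ x)
if-<ᵇ-suc x (suc a) zero    = refl
if-<ᵇ-suc x (suc a) (suc b) = if-<ᵇ-suc x a b

sumBy : (A → ℕ) → List A → ℕ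
sumBy f []       = 0
sumBy f (x ∷ xs) = f x + sumBy f xs

sumBy-++ : (f : A → ℕ) (xs ys : List A) → sumBy f (xs ++ ys) ≡ sumBy f xs + sumBy f ys
sumBy-++ f []       ys = refl
sumBy-++ f (x ∷ xs) ys = trans (cong (f x +_) (sumBy-++ f xs ys)) (sym (+-assoc (f x) _ _))

sumBy-map : (f : B → ℕ) (g : A → B) (xs : List A) → sumBy f (map g xs) ≡ sumBy (f ∘ g) xs
sumBy-map f g []       = refl
sumBy-map f g (x ∷ xs) = cong (f (g x) +_) (sumBy-map f g xs)

sumBy-concatMap : (f : B → ℕ) (g : A → List B) (xs : List A) →
  sumBy f (concatMap g xs) ≡ sumBy (sumBy f ∘ g) xs
sumBy-concatMap f g []       = refl
sumBy-concatMap f g (x ∷ xs) =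
  trans (sumBy-++ f (g x) (concatMap g xs)) (cong (sumBy f (g x) +_) (sumBy-concatMap f g xs))

sumBy-filterᵇ : (f : A → ℕ) (P : A → Bool) (xs : List A) →
  sumBy f (filterᵇ P xs) ≡ sumBy (λ x → if P x then f x else 0) xs
sumBy-filterᵇ f P []       = refl
sumBy-filterᵇ f P (x ∷ xs) with P x
... | true  = cong (f x +_) (sumBy-filterᵇ f P xs)
... | false = sumBy-filterᵇ f P xs

sumBy-cong : {f g : A → ℕ} (xs : List A) → (∀ x → f x ≡ g x) → sumBy f xs ≡ sumBy g xs
sumBy-cong []       f≗g = refl
sumBy-cong (x ∷ xs) f≗g = cong₂ _+_ (f≗g x) (sumBy-cong xs f≗g)

sumBy-congᴬ : {f g : A → ℕ} {xs : List A} → All (λ x → f x ≡ g x) xs → sumBy f xs ≡ sumBy g xs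
sumBy-congᴬ []       = refl
sumBy-congᴬ (e ∷ es) = cong₂ _+_ e (sumBy-congᴬ es)

sumBy-+ : (f g : A → ℕ) (xs : List A) → sumBy (λ x → f x + g x) xs ≡ sumBy f xs + sumBy g xs
sumBy-+ f g []       = refl
sumBy-+ f g (x ∷ xs) = trans (cong (f x + g x +_) (sumBy-+ f g xs)) (+-interchange (f x) (g x) _ _)

sumBy-*ˡ : (c : ℕ) (f : A → ℕ) (xs : List A) → sumBy (λ x → c * f x) xs ≡ c * sumBy f xs
sumBy-*ˡ c f []       = sym (*-zeroʳ c)
sumBy-*ˡ c f (x ∷ xs) = trans (cong (c * f x +_) (sumBy-*ˡ c f xs)) (sym (*-distribˡ-+ c (f x) _))

sumBy-const : (a : ℕ) (xs : List A) → sumBy (λ _ → a) xs ≡ length xs * a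
sumBy-const a []       = refl
sumBy-const a (x ∷ xs) = cong (a +_) (sumBy-const a xs)

sumBy-zero : (xs : List A) → sumBy (λ _ → 0) xs ≡ 0
sumBy-zero xs = trans (sumBy-const 0 xs) (*-zeroʳ (length xs))

countᵇ : (A → Bool) → List A → ℕ
countᵇ P = sumBy (λ x → if P x then 1 else 0)

sumBy-if : (c : ℕ) (P : A → Bool) (xs : List A) →
  sumBy (λ x → if P x then c else 0) xs ≡ c * countᵇ P xs
sumBy-if c P xs = trans (sumBy-cong xs scale) (sumBy-*ˡ c (λ x → if P x then 1 else 0) xs)
  where
  scale : ∀ x → (if P x then c else 0) ≡ c * (if P x then 1 else 0)
  scale x with P x
  ... | true  = sym (*-identityʳ c)
  ... | false = sym (*-zeroʳ c)

countᵇ-cong : {P Q : A → Bool} (xs : List A) → (∀ x → P x ≡ Q x) → countᵇ P xs ≡ countᵇ Q xs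
countᵇ-cong xs P≗Q = sumBy-cong xs (λ x → cong (λ b → if b then 1 else 0) (P≗Q x))

countᵇ-false : (xs : List A) → countᵇ (λ _ → false) xs ≡ 0
countᵇ-false = sumBy-zero

countᵇ-true : (xs : List A) → countᵇ (λ _ → true) xs ≡ length xs
countᵇ-true xs = trans (sumBy-const 1 xs) (*-identityʳ (length xs))

countᵇ-∖ : (P Q : A → Bool) (xs : List A) → (∀ x → Q x ≡ true → P x ≡ true) →
  countᵇ (λ x → P x ∧ not (Q x)) xs + countᵇ Q xs ≡ countᵇ P xs
countᵇ-∖ P Q xs Q⊆P = trans (sym (sumBy-+ _ _ xs)) (sumBy-cong xs split)
  where
  split : ∀ x → (if P x ∧ not (Q x) then 1 else 0) + (if Q x then 1 else 0) ≡ (if P x then 1 else 0)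
  split x with P x in px | Q x in qx
  ... | true  | true  = refl
  ... | true  | false = refl
  ... | false | false = refl
  ... | false | true  with () ← trans (sym px) (Q⊆P x qx)

sumBy-upTo-suc : (f : ℕ → ℕ) (b : ℕ) → sumBy f (upTo (suc b)) ≡ sumBy f (upTo b) + f b
sumBy-upTo-suc f b = begin
  sumBy f (upTo (suc b))           ≡⟨ cong (sumBy f) (sym (applyUpTo-∷ʳ (λ x → x) b)) ⟩
  sumBy f (upTo b ++ b ∷ [])       ≡⟨ sumBy-++ f (upTo b) (b ∷ []) ⟩
  sumBy f (upTo b) + (f b + 0)     ≡⟨ cong (sumBy f (upTo b) +_) (+-identityʳ (f b)) ⟩
  sumBy f (upTo b) + f b           ∎
  where open ≡-Reasoning

countᵇ-const-upTo : (b : ℕ) (t : Bool) → countᵇ (λ _ → t) (upTo b) ≡ (if t then b else 0)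
countᵇ-const-upTo b true  = trans (countᵇ-true (upTo b)) (length-upTo b)
countᵇ-const-upTo b false = countᵇ-false (upTo b)

countᵇ-≡ᵇ-upTo : (c b : ℕ) → countᵇ (_≡ᵇ c) (upTo b) ≡ (if c <ᵇ b then 1 else 0)
countᵇ-≡ᵇ-upTo c zero    = refl
countᵇ-≡ᵇ-upTo c (suc b) = begin
  countᵇ (_≡ᵇ c) (upTo (suc b))
    ≡⟨ sumBy-upTo-suc (λ x → if x ≡ᵇ c then 1 else 0) b ⟩
  countᵇ (_≡ᵇ c) (upTo b) + (if b ≡ᵇ c then 1 else 0)
    ≡⟨ cong₂ _+_ (countᵇ-≡ᵇ-upTo c b) (cong (λ t → if t then 1 else 0) (≡ᵇ-sym b c)) ⟩
  (if c <ᵇ b then 1 else 0) + (if c ≡ᵇ b then 1 else 0)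
    ≡⟨ sym (if-<ᵇ-suc 1 c b) ⟩
  (if c <ᵇ suc b then 1 else 0) ∎
  where open ≡-Reasoning

countᵇ-≡ᵇ-upTo-< : ∀ {c b} → c < b → countᵇ (_≡ᵇ c) (upTo b) ≡ 1
countᵇ-≡ᵇ-upTo-< {c} {b} c<b = trans (countᵇ-≡ᵇ-upTo c b) (cong (λ t → if t then 1 else 0) (<ᵇ-true c<b))

filterᵇ-concatMap : (P : B → Bool) (g : A → List B) (xs : List A) →
  filterᵇ P (concatMap g xs) ≡ concatMap (filterᵇ P ∘ g) xs
filterᵇ-concatMap P g []       = refl
filterᵇ-concatMap P g (x ∷ xs) =
  trans (filter-++ (T? ∘ P) (g x) (concatMap g xs)) (cong (filterᵇ P (g x) ++_) (filterᵇ-concatMap P g xs))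

concatMap-filterᵇ : (g : A → List B) (P : A → Bool) (xs : List A) → (∀ x → P x ≡ false → g x ≡ []) →
  concatMap g xs ≡ concatMap g (filterᵇ P xs)
concatMap-filterᵇ g P []       _ = refl
concatMap-filterᵇ g P (x ∷ xs) g-vanishes with P x in px
... | true  = cong (g x ++_) (concatMap-filterᵇ g P xs g-vanishes)
... | false = trans (cong (_++ concatMap g xs) (g-vanishes x px)) (concatMap-filterᵇ g P xs g-vanishes)

∑₁ : ℕ → (ℕ → ℕ) → ℕ
∑₁ zero    f = 0
∑₁ (suc N) f = ∑₁ N f + f (suc N)

∑₁-suc : ∀ N f → ∑₁ (suc N) f ≡ f 1 + ∑₁ N (f ∘ suc)
∑₁-suc zero    f = +-comm 0 (f 1)
∑₁-suc (suc N) f = trans (cong (_+ f (suc (suc N))) (∑₁-suc N f)) (+-assoc (f 1) _ _)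

∑₁-cong : ∀ N {f g : ℕ → ℕ} → (∀ d → 1 ≤ d → d ≤ N → f d ≡ g d) → ∑₁ N f ≡ ∑₁ N g
∑₁-cong zero    f≗g = refl
∑₁-cong (suc N) f≗g =
  cong₂ _+_ (∑₁-cong N (λ d 1≤d d≤N → f≗g d 1≤d (m≤n⇒m≤1+n d≤N))) (f≗g (suc N) (s≤s z≤n) ≤-refl)

∑₁-zero : ∀ N (f : ℕ → ℕ) → (∀ d → 1 ≤ d → d ≤ N → f d ≡ 0) → ∑₁ N f ≡ 0
∑₁-zero zero    f f≗0 = refl
∑₁-zero (suc N) f f≗0 =
  cong₂ _+_ (∑₁-zero N f (λ d 1≤d d≤N → f≗0 d 1≤d (m≤n⇒m≤1+n d≤N)))
            (f≗0 (suc N) (s≤s z≤n) ≤-refl)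

∑₁-+ : ∀ N (f g : ℕ → ℕ) → ∑₁ N (λ d → f d + g d) ≡ ∑₁ N f + ∑₁ N g
∑₁-+ zero    f g = refl
∑₁-+ (suc N) f g =
  trans (cong (_+ (f (suc N) + g (suc N))) (∑₁-+ N f g)) (+-interchange (∑₁ N f) (∑₁ N g) _ _)

∑₁-*ˡ : ∀ N c (f : ℕ → ℕ) → ∑₁ N (λ d → c * f d) ≡ c * ∑₁ N f
∑₁-*ˡ zero    c f = sym (*-zeroʳ c)
∑₁-*ˡ (suc N) c f = trans (cong (_+ c * f (suc N)) (∑₁-*ˡ N c f)) (sym (*-distribˡ-+ c (∑₁ N f) (f (suc N))))

∑₁-+-split : ∀ a b (f : ℕ → ℕ) → ∑₁ (a + b) f ≡ ∑₁ a f + ∑₁ b (λ d → f (a + d))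
∑₁-+-split a zero    f = trans (cong (λ N → ∑₁ N f) (+-identityʳ a)) (sym (+-identityʳ _))
∑₁-+-split a (suc b) f rewrite +-suc a b | ∑₁-+-split a b f = +-assoc (∑₁ a f) _ _

2*suc : ∀ m → 2 * suc m ≡ suc (suc (2 * m))
2*suc m = cong suc (+-suc m (m + 0))

^-double : ∀ x m → x ^ (2 * m) ≡ x ^ m * x ^ m
^-double x m = trans (^-distribˡ-+-* x m (m + 0)) (cong (λ e → x ^ m * x ^ e) (+-identityʳ m))

half-double : ∀ x → (2 * x) / 2 ≡ x
half-double x = trans (cong (_/ 2) (*-comm 2 x)) (m*n/n≡m x 2)

triangle : ℕ → ℕ
triangle zero    = 0
triangle (suc x) = triangle x + suc x

triangle-double : ∀ x → suc x * x ≡ 2 * triangle x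
triangle-double zero    = refl
triangle-double (suc x) =
  trans (step x) (trans (cong (_+ 2 * suc x) (triangle-double x)) (sym (*-distribˡ-+ 2 (triangle x) (suc x))))
  where
  step : ∀ x → suc (suc x) * suc x ≡ suc x * x + 2 * suc x
  step = solve-∀

_≟ᵥ_ : (u v : Vertex) → Dec (u ≡ v)
_≟ᵥ_ = ≡-dec _≟_

==ᵥ-refl : (u : Vertex) → (u ==ᵥ u) ≡ true
==ᵥ-refl u = dec-true (u ≟ᵥ u) refl

==ᵥ-false : {u v : Vertex} → u ≢ v → (u ==ᵥ v) ≡ false
==ᵥ-false {u} {v} = dec-false (u ≟ᵥ v)

==ᵥ⇒≡ : {u v : Vertex} → (u ==ᵥ v) ≡ true → u ≡ v
==ᵥ⇒≡ {u} {v} with u ≟ᵥ v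
... | yes u≡v = λ _ → u≡v

not-==ᵥ⇒≢ : {u v : Vertex} → not (u ==ᵥ v) ≡ true → u ≢ v
not-==ᵥ⇒≢ {u} e refl with () ← trans (cong not (sym (==ᵥ-refl u))) e

==ᵥ-sym : (u v : Vertex) → (u ==ᵥ v) ≡ (v ==ᵥ u)
==ᵥ-sym u v with u ≟ᵥ v
... | yes refl = sym (==ᵥ-refl u)
... | no  u≢v  = sym (==ᵥ-false (u≢v ∘ sym))

≢-length : {u v : Vertex} → length u ≢ length v → u ≢ v
≢-length ne eq = ne (cong length eq)

∷≢ : (c : ℕ) (u : Vertex) → (c ∷ u) ≢ u
∷≢ c u = ≢-length {c ∷ u} {u} 1+n≢n

childOf⇒∷ : (u v : Vertex) → childOf u v ≡ true → ∃ λ c → v ≡ c ∷ u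
childOf⇒∷ u (c ∷ w) e = c , cong (c ∷_) (==ᵥ⇒≡ e)

childOf-asym : (u v : Vertex) → childOf u v ≡ true → childOf v u ≡ false
childOf-asym u v e with childOf⇒∷ u v e
childOf-asym []      _ e | c , refl = refl
childOf-asym (d ∷ u) _ e | c , refl =
  ==ᵥ-false {u} {c ∷ d ∷ u} (≢-length {u} {c ∷ d ∷ u} (<⇒≢ (≤-trans (n<1+n (length u)) (n≤1+n _))))

notIn-∷⁻ : (y z : Vertex) (zs : List Vertex) → notIn y (z ∷ zs) ≡ true → y ≢ z × notIn y zs ≡ true
notIn-∷⁻ y z zs e with y≠z , fresh ← ∧-true {not (y ==ᵥ z)} e = not-==ᵥ⇒≢ y≠z , fresh

notIn⁺ : {y : Vertex} {zs : List Vertex} → All (y ≢_) zs → notIn y zs ≡ true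
notIn⁺ []                 = refl
notIn⁺ {y} {z ∷ zs} (y≢z ∷ ns) = cong₂ (λ a b → not a ∧ b) (==ᵥ-false y≢z) (notIn⁺ ns)

notIn-∷-∷ : (x h : Vertex) (zs : List Vertex) → notIn x (h ∷ x ∷ zs) ≡ false
notIn-∷-∷ x h zs = trans (cong (λ b → not (x ==ᵥ h) ∧ (not b ∧ notIn x zs)) (==ᵥ-refl x)) (∧-zeroʳ _)

isOrientedPath-∷-∷ : (y h : Vertex) (zs : List Vertex) →
  isOrientedPath (y ∷ h ∷ zs) ≡ (notIn y (h ∷ zs) ∧ adjacent y h) ∧ isOrientedPath (h ∷ zs)
isOrientedPath-∷-∷ y h zs = ∧-interchange (notIn y (h ∷ zs)) (allDistinct (h ∷ zs)) (adjacent y h) _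

isOrientedPath-extend : (y h : Vertex) (zs : List Vertex) → isOrientedPath (h ∷ zs) ≡ true →
  isOrientedPath (y ∷ h ∷ zs) ≡ notIn y (h ∷ zs) ∧ adjacent y h
isOrientedPath-extend y h zs p =
  trans (isOrientedPath-∷-∷ y h zs) (trans (cong ((notIn y (h ∷ zs) ∧ adjacent y h) ∧_) p) (∧-identityʳ _))

isOrientedPath-tail : (y : Vertex) (zs : List Vertex) → isOrientedPath (y ∷ zs) ≡ true → isOrientedPath zs ≡ true
isOrientedPath-tail y []       _ = refl
isOrientedPath-tail y (h ∷ zs) p =
  proj₂ (∧-true {notIn y (h ∷ zs) ∧ adjacent y h} (trans (sym (isOrientedPath-∷-∷ y h zs)) p))

-- In the address encoding, v lies in the subtree rooted at u exactly when u is a suffix of v.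
_⊑_ : Vertex → Vertex → Set
u ⊑ v = ∃ λ w → v ≡ w ++ u

⊑-refl : (u : Vertex) → u ⊑ u
⊑-refl u = [] , refl

⊑-∷ : {u v : Vertex} (c : ℕ) → u ⊑ v → u ⊑ (c ∷ v)
⊑-∷ c (w , refl) = c ∷ w , refl

⊑-trans : {u v x : Vertex} → u ⊑ v → v ⊑ x → u ⊑ x
⊑-trans {u} (w₁ , refl) (w₂ , refl) = w₂ ++ w₁ , sym (++-assoc w₂ w₁ u)

⊑-length : {u v : Vertex} → u ⊑ v → length u ≤ length v
⊑-length {u} (w , refl) = length-++-≤ʳ u {w}

∷⋢ : (c : ℕ) (u : Vertex) → ¬ (c ∷ u) ⊑ u
∷⋢ c u u⊑ = 1+n≰n (⊑-length u⊑)

⊑-length-≡ : {u v : Vertex} → u ⊑ v → length v ≡ length u → v ≡ u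
⊑-length-≡ ([]    , refl) _ = refl
⊑-length-≡ {u} (x ∷ w , refl) e = ⊥-elim (1+n≰n (subst (_≤ length (w ++ u)) (sym e) (length-++-≤ʳ u {w})))

⊑-unique : {u v x : Vertex} → u ⊑ x → v ⊑ x → length u ≡ length v → u ≡ v
⊑-unique (w₁ , refl) (w₂ , e) = strip w₁ w₂ e
  where
  strip : ∀ {u v} (w₁ w₂ : Vertex) → w₁ ++ u ≡ w₂ ++ v → length u ≡ length v → u ≡ v
  strip []       w₂       e l = ⊑-length-≡ (w₂ , e) l
  strip (x ∷ w₁) []       e l = sym (⊑-length-≡ (x ∷ w₁ , sym e) (sym l))
  strip (x ∷ w₁) (y ∷ w₂) e l = strip w₁ w₂ (∷-injectiveʳ e) l

-- The vertices of T_{n,k}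

module Levels (k : ℕ) where

  branching : ℕ → ℕ
  branching zero    = k
  branching (suc _) = k ∸ 1

  IsAddress : Vertex → Set
  IsAddress []      = ⊤
  IsAddress (c ∷ u) = c < branching (length u) × IsAddress u

  level-sound : ∀ d → All (λ v → length v ≡ d × IsAddress v) (level k d)
  level-sound zero          = (refl , tt) ∷ []
  level-sound (suc zero)    = map⁺ (applyUpTo⁺₁ (λ c → c) k (λ c<k → refl , c<k , tt))
  level-sound (suc (suc d)) = concat⁺ (map⁺ (All.map children-sound (level-sound (suc d))))
    where
    children-sound : ∀ {u} → length u ≡ suc d × IsAddress u →
      All (λ v → length v ≡ suc (suc d) × IsAddress v) (map (_∷ u) (upTo (k ∸ 1)))
    children-sound {_ ∷ _} (l , a) = map⁺ (applyUpTo⁺₁ (λ c → c) (k ∸ 1) (λ c<k-1 → cong suc l , c<k-1 , a))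

  vertices-sound : ∀ N → All (λ v → length v ≤ N × IsAddress v) (vertices N k)
  vertices-sound zero    = All.map (λ (l , a) → ≤-reflexive l , a) (level-sound zero)
  vertices-sound (suc N) = ++⁺ (All.map (λ (l , a) → m≤n⇒m≤1+n l , a) (vertices-sound N))
                               (All.map (λ (l , a) → ≤-reflexive l , a) (level-sound (suc N)))

  sumBy-level-suc : ∀ d (f : Vertex → ℕ) →
    sumBy f (level k (suc (suc d))) ≡ sumBy (λ u → sumBy (λ c → f (c ∷ u)) (upTo (k ∸ 1))) (level k (suc d))
  sumBy-level-suc d f =
    trans (sumBy-concatMap f (λ u → map (_∷ u) (upTo (k ∸ 1))) (level k (suc d)))
          (sumBy-cong (level k (suc d)) (λ u → sumBy-map f (_∷ u) (upTo (k ∸ 1))))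

  private
    countᵇ-∷-==ᵥ : (b c₀ : ℕ) (u₀ u : Vertex) →
      countᵇ (λ c → (c ∷ u) ==ᵥ (c₀ ∷ u₀)) (upTo b)
        ≡ (if u ==ᵥ u₀ then countᵇ (_≡ᵇ c₀) (upTo b) else 0)
    countᵇ-∷-==ᵥ b c₀ u₀ u with u ==ᵥ u₀
    ... | true  = countᵇ-cong (upTo b) (λ c → ∧-identityʳ (c ≡ᵇ c₀))
    ... | false = trans (countᵇ-cong (upTo b) (λ c → ∧-zeroʳ (c ≡ᵇ c₀))) (countᵇ-false (upTo b))

  count-level-≡ : ∀ d x → IsAddress x → countᵇ (_==ᵥ x) (level k d) ≡ (if length x ≡ᵇ d then 1 else 0)
  count-level-≡ zero          []      _ = refl
  count-level-≡ zero          (_ ∷ _) _ = refl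
  count-level-≡ (suc zero)    x       a =
    trans (sumBy-map (λ y → if y ==ᵥ x then 1 else 0) (_∷ []) (upTo k)) (roots x a)
    where
    roots : ∀ x → IsAddress x →
      countᵇ (λ c → (c ∷ []) ==ᵥ x) (upTo k) ≡ (if length x ≡ᵇ 1 then 1 else 0)
    roots []             _         = countᵇ-false (upTo k)
    roots (c₀ ∷ [])      (c₀<k , _) =
      trans (countᵇ-cong (upTo k) (λ c → ∧-identityʳ (c ≡ᵇ c₀))) (countᵇ-≡ᵇ-upTo-< c₀<k)
    roots (c₀ ∷ _ ∷ _)   _         =
      trans (countᵇ-cong (upTo k) (λ c → ∧-zeroʳ (c ≡ᵇ c₀))) (countᵇ-false (upTo k))
  count-level-≡ (suc (suc d)) []        _ =
    trans (sumBy-level-suc d (λ y → if y ==ᵥ [] then 1 else 0))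
          (trans (sumBy-cong (level k (suc d)) (λ u → countᵇ-false (upTo (k ∸ 1))))
                 (sumBy-zero (level k (suc d))))
  count-level-≡ (suc (suc d)) (c₀ ∷ u₀) (c₀<b , a) = begin
    countᵇ (_==ᵥ (c₀ ∷ u₀)) (level k (suc (suc d)))
      ≡⟨ sumBy-level-suc d (λ y → if y ==ᵥ (c₀ ∷ u₀) then 1 else 0) ⟩
    sumBy (λ u → countᵇ (λ c → (c ∷ u) ==ᵥ (c₀ ∷ u₀)) (upTo (k ∸ 1))) (level k (suc d))
      ≡⟨ sumBy-cong (level k (suc d)) (countᵇ-∷-==ᵥ (k ∸ 1) c₀ u₀) ⟩
    sumBy (λ u → if u ==ᵥ u₀ then m else 0) (level k (suc d))
      ≡⟨ sumBy-if m (_==ᵥ u₀) (level k (suc d)) ⟩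
    m * countᵇ (_==ᵥ u₀) (level k (suc d))
      ≡⟨ cong (m *_) (count-level-≡ (suc d) u₀ a) ⟩
    m * (if length u₀ ≡ᵇ suc d then 1 else 0)
      ≡⟨ at-depth u₀ c₀<b ⟩
    (if length (c₀ ∷ u₀) ≡ᵇ suc (suc d) then 1 else 0) ∎
    where
    open ≡-Reasoning
    m = countᵇ (_≡ᵇ c₀) (upTo (k ∸ 1))
    at-depth : ∀ u₀ → c₀ < branching (length u₀) →
      m * (if length u₀ ≡ᵇ suc d then 1 else 0) ≡ (if length (c₀ ∷ u₀) ≡ᵇ suc (suc d) then 1 else 0)
    at-depth []      _      = *-zeroʳ m
    at-depth (_ ∷ u) c₀<k-1 =
      trans (cong (_* (if length u ≡ᵇ d then 1 else 0)) (countᵇ-≡ᵇ-upTo-< c₀<k-1)) (+-identityʳ _)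

  count-level-childOf : ∀ d h → IsAddress h →
    countᵇ (childOf h) (level k d) ≡ (if suc (length h) ≡ᵇ d then branching (length h) else 0)
  count-level-childOf zero          h _ = refl
  count-level-childOf (suc zero)    h _ =
    trans (sumBy-map (λ y → if childOf h y then 1 else 0) (_∷ []) (upTo k)) (roots h)
    where
    roots : ∀ h →
      countᵇ (λ _ → [] ==ᵥ h) (upTo k) ≡ (if suc (length h) ≡ᵇ 1 then branching (length h) else 0)
    roots []      = trans (countᵇ-true (upTo k)) (length-upTo k)
    roots (_ ∷ _) = countᵇ-false (upTo k)
  count-level-childOf (suc (suc d)) h a = begin
    countᵇ (childOf h) (level k (suc (suc d)))
      ≡⟨ sumBy-level-suc d (λ y → if childOf h y then 1 else 0) ⟩
    sumBy (λ u → countᵇ (λ _ → u ==ᵥ h) (upTo (k ∸ 1))) (level k (suc d))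
      ≡⟨ sumBy-cong (level k (suc d)) (λ u → countᵇ-const-upTo (k ∸ 1) (u ==ᵥ h)) ⟩
    sumBy (λ u → if u ==ᵥ h then k ∸ 1 else 0) (level k (suc d))
      ≡⟨ sumBy-if (k ∸ 1) (_==ᵥ h) (level k (suc d)) ⟩
    (k ∸ 1) * countᵇ (_==ᵥ h) (level k (suc d))
      ≡⟨ cong ((k ∸ 1) *_) (count-level-≡ (suc d) h a) ⟩
    (k ∸ 1) * (if length h ≡ᵇ suc d then 1 else 0)
      ≡⟨ at-depth h ⟩
    (if suc (length h) ≡ᵇ suc (suc d) then branching (length h) else 0) ∎
    where
    open ≡-Reasoning
    at-depth : ∀ h → (k ∸ 1) * (if length h ≡ᵇ suc d then 1 else 0)
                   ≡ (if suc (length h) ≡ᵇ suc (suc d) then branching (length h) else 0)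
    at-depth []      = *-zeroʳ (k ∸ 1)
    at-depth (_ ∷ u) with length u ≡ᵇ d
    ... | true  = *-identityʳ (k ∸ 1)
    ... | false = *-zeroʳ (k ∸ 1)

  count-vertices-≡ : ∀ N x → IsAddress x →
    countᵇ (_==ᵥ x) (vertices N k) ≡ (if length x <ᵇ suc N then 1 else 0)
  count-vertices-≡ zero    []      a = refl
  count-vertices-≡ zero    (_ ∷ _) a = refl
  count-vertices-≡ (suc N) x       a = begin
    countᵇ (_==ᵥ x) (vertices N k ++ level k (suc N))
      ≡⟨ sumBy-++ (λ y → if y ==ᵥ x then 1 else 0) (vertices N k) (level k (suc N)) ⟩
    countᵇ (_==ᵥ x) (vertices N k) + countᵇ (_==ᵥ x) (level k (suc N))
      ≡⟨ cong₂ _+_ (count-vertices-≡ N x a) (count-level-≡ (suc N) x a) ⟩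
    (if length x <ᵇ suc N then 1 else 0) + (if length x ≡ᵇ suc N then 1 else 0)
      ≡⟨ sym (if-<ᵇ-suc 1 (length x) (suc N)) ⟩
    (if length x <ᵇ suc (suc N) then 1 else 0) ∎
    where open ≡-Reasoning

  count-vertices-childOf : ∀ N h → IsAddress h →
    countᵇ (childOf h) (vertices N k) ≡ (if length h <ᵇ N then branching (length h) else 0)
  count-vertices-childOf zero    h a = count-level-childOf zero h a
  count-vertices-childOf (suc N) h a = begin
    countᵇ (childOf h) (vertices N k ++ level k (suc N))
      ≡⟨ sumBy-++ (λ y → if childOf h y then 1 else 0) (vertices N k) (level k (suc N)) ⟩
    countᵇ (childOf h) (vertices N k) + countᵇ (childOf h) (level k (suc N))
      ≡⟨ cong₂ _+_ (count-vertices-childOf N h a) (count-level-childOf (suc N) h a) ⟩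
    (if length h <ᵇ N then branching (length h) else 0) + (if length h ≡ᵇ N then branching (length h) else 0)
      ≡⟨ sym (if-<ᵇ-suc (branching (length h)) (length h) N) ⟩
    (if length h <ᵇ suc N then branching (length h) else 0) ∎
    where open ≡-Reasoning

-- Oriented paths as non-backtracking walks

-- How the head of a path was entered: it is the only vertex, or the next vertex is a child of
-- it, or the next vertex is its parent.
data Arrival : Set where
  start fromChild fromParent : Arrival

module Dendrimer (n k : ℕ) where
  open Levels k

  V : List Vertex
  V = vertices n k

  InTree : Vertex → Set
  InTree v = length v ≤ n × IsAddress v

  all-InTree : All InTree V
  all-InTree = vertices-sound n

  childCount : ℕ → ℕ
  childCount d = if d <ᵇ n then branching d else 0

  parentCount : ℕ → ℕ
  parentCount zero    = 0
  parentCount (suc _) = 1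

  occurs-once : ∀ x → InTree x → countᵇ (_==ᵥ x) V ≡ 1
  occurs-once x (x≤n , a) = trans (count-vertices-≡ n x a) (cong (λ b → if b then 1 else 0) (<ᵇ-true (s≤s x≤n)))

  count-children : ∀ h → InTree h → countᵇ (childOf h) V ≡ childCount (length h)
  count-children h (_ , a) = count-vertices-childOf n h a

  count-parents : ∀ h → InTree h → countᵇ (λ y → childOf y h) V ≡ parentCount (length h)
  count-parents []      _                = countᵇ-false V
  count-parents (c ∷ u) (cu≤n , (_ , a)) =
    trans (countᵇ-cong V (λ y → ==ᵥ-sym u y)) (occurs-once u (<⇒≤ cu≤n , a))

  -- Non-backtracking walks of length r from a vertex at depth d that was entered as described by a.
  walks : ℕ → Arrival → ℕ → ℕ
  walks zero    _          d = 1
  walks (suc r) start      d = childCount d * walks r fromParent (suc d) + parentCount d * walks r fromChild (pred d)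
  walks (suc r) fromChild  d = (childCount d ∸ 1) * walks r fromParent (suc d) + parentCount d * walks r fromChild (pred d)
  walks (suc r) fromParent d = childCount d * walks r fromParent (suc d)

  freshChildren : Arrival → ℕ → ℕ
  freshChildren start      d = childCount d
  freshChildren fromChild  d = childCount d ∸ 1
  freshChildren fromParent d = childCount d

  freshParents : Arrival → ℕ → ℕ
  freshParents start      d = parentCount d
  freshParents fromChild  d = parentCount d
  freshParents fromParent d = 0

  walks-suc : ∀ r a d →
    walks (suc r) a d ≡ freshChildren a d * walks r fromParent (suc d) + freshParents a d * walks r fromChild (pred d)
  walks-suc r start      d = refl
  walks-suc r fromChild  d = refl
  walks-suc r fromParent d = sym (+-identityʳ _)

  arrival : List Vertex → Arrival
  arrival (h ∷ x ∷ _) = if length x ≡ᵇ suc (length h) then fromChild else fromParent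
  arrival _           = start

  headDepth : List Vertex → ℕ
  headDepth []      = 0
  headDepth (h ∷ _) = length h

  -- The number of ways to grow the path p by r more vertices at its head.
  extensions : ℕ → List Vertex → ℕ
  extensions r p = walks r (arrival p) (headDepth p)

  -- For a path h ∷ x ∷ rest, either x is a child of h and rest lies below x (h was reached
  -- upwards), or h is a child of x and nothing after h lies below h (h was reached downwards).
  Shape : List Vertex → Set
  Shape (h ∷ x ∷ rest) = ((∃ λ c → x ≡ c ∷ h) × All (x ⊑_) rest)
                       ⊎ ((∃ λ c → h ≡ c ∷ x) × All (λ z → ¬ h ⊑ z) (x ∷ rest))
  Shape _              = ⊤

  TreePath : List Vertex → Set
  TreePath []      = ⊥
  TreePath (h ∷ p) = isOrientedPath (h ∷ p) ≡ true × Shape (h ∷ p) × All InTree (h ∷ p)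

  Shape-child : (c : ℕ) (h : Vertex) (rest : List Vertex) → Shape (h ∷ rest) →
    notIn (c ∷ h) (h ∷ rest) ≡ true → Shape ((c ∷ h) ∷ h ∷ rest)
  Shape-child c h []       _ _ = inj₂ ((c , refl) , ∷⋢ c h ∷ [])
  Shape-child c h (x ∷ rest) (inj₁ ((c₀ , refl) , below)) fresh =
    inj₂ ((c , refl) , ∷⋢ c h ∷ (λ s → c∷h≢c₀∷h (sym (⊑-length-≡ s refl)))
                              ∷ All.map (λ s₀ s → c∷h≢c₀∷h (⊑-unique s s₀ refl)) below)
    where
    c∷h≢c₀∷h : (c ∷ h) ≢ (c₀ ∷ h)
    c∷h≢c₀∷h =
      proj₁ (notIn-∷⁻ (c ∷ h) (c₀ ∷ h) rest (proj₂ (notIn-∷⁻ (c ∷ h) h ((c₀ ∷ h) ∷ rest) fresh)))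
  Shape-child c h (x ∷ rest) (inj₂ ((c₀ , refl) , notBelow)) _ =
    inj₂ ((c , refl) , ∷⋢ c h ∷ All.map (λ ¬s s → ¬s (⊑-trans (⊑-∷ c (⊑-refl h)) s)) notBelow)

  Shape-parent : (c : ℕ) (y : Vertex) (rest : List Vertex) → Shape ((c ∷ y) ∷ rest) →
    notIn y ((c ∷ y) ∷ rest) ≡ true → Shape (y ∷ (c ∷ y) ∷ rest)
  Shape-parent c y []       _ _ = inj₁ ((c , refl) , [])
  Shape-parent c y (x ∷ rest) (inj₁ ((c₀ , refl) , below)) _ =
    inj₁ ((c , refl) , (c₀ ∷ [] , refl) ∷ All.map (⊑-trans (c₀ ∷ [] , refl)) below)
  Shape-parent c y (x ∷ rest) (inj₂ ((c₀ , e) , _)) fresh =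
    ⊥-elim (proj₁ (notIn-∷⁻ y x rest (proj₂ (notIn-∷⁻ y (c ∷ y) (x ∷ rest) fresh))) (∷-injectiveʳ e))

  Shape-extend : (y h : Vertex) (rest : List Vertex) → Shape (h ∷ rest) →
    notIn y (h ∷ rest) ≡ true → adjacent y h ≡ true → Shape (y ∷ h ∷ rest)
  Shape-extend y h rest s fresh adj with childOf h y in y-child
  ... | true  with c , refl ← childOf⇒∷ h y y-child = Shape-child c h rest s fresh
  ... | false with c , refl ← childOf⇒∷ y h (trans (sym (∨-identityʳ (childOf y h))) adj) =
    Shape-parent c y rest s fresh

  TreePath-extend : (y : Vertex) (p : List Vertex) → TreePath p → InTree y →
    isOrientedPath (y ∷ p) ≡ true → TreePath (y ∷ p)
  TreePath-extend y (h ∷ rest) (path , s , inTree) y∈ ext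
    with fresh , adj ← ∧-true (trans (sym (isOrientedPath-extend y h rest path)) ext) =
    ext , Shape-extend y h rest s fresh adj , y∈ ∷ inTree

  arrival-upwards : (c : ℕ) (h : Vertex) (rest : List Vertex) → arrival (h ∷ (c ∷ h) ∷ rest) ≡ fromChild
  arrival-upwards c h rest = cong (λ b → if b then fromChild else fromParent) (≡ᵇ-true {length h} refl)

  arrival-downwards : (c : ℕ) (x : Vertex) (rest : List Vertex) → arrival ((c ∷ x) ∷ x ∷ rest) ≡ fromParent
  arrival-downwards c x rest =
    cong (λ b → if b then fromChild else fromParent) (≡ᵇ-false (<⇒≢ (≤-trans (n<1+n (length x)) (n≤1+n _))))

  extensions-child : (r : ℕ) (h y : Vertex) (rest : List Vertex) → childOf h y ≡ true →
    extensions r (y ∷ h ∷ rest) ≡ walks r fromParent (suc (length h))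
  extensions-child r h y rest y-child with c , refl ← childOf⇒∷ h y y-child =
    cong (λ a → walks r a (suc (length h))) (arrival-downwards c h rest)

  extensions-parent : (r : ℕ) (h y : Vertex) (rest : List Vertex) → childOf y h ≡ true →
    extensions r (y ∷ h ∷ rest) ≡ walks r fromChild (pred (length h))
  extensions-parent r h y rest h-child with c , refl ← childOf⇒∷ y h h-child =
    cong (λ a → walks r a (length y)) (arrival-upwards c y rest)

  extension-split : (r : ℕ) (h : Vertex) (rest : List Vertex) → isOrientedPath (h ∷ rest) ≡ true → ∀ y →
    (if isOrientedPath (y ∷ h ∷ rest) then extensions r (y ∷ h ∷ rest) else 0) ≡
    (if childOf h y ∧ notIn y (h ∷ rest) then walks r fromParent (suc (length h)) else 0) +
    (if childOf y h ∧ notIn y (h ∷ rest) then walks r fromChild (pred (length h)) else 0)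
  extension-split r h rest path y =
    trans (cong (λ b → if b then extensions r (y ∷ h ∷ rest) else 0) (isOrientedPath-extend y h rest path))
          (if-∧-∨ (notIn y (h ∷ rest)) (childOf h y) (childOf y h)
                  (extensions-child r h y rest) (extensions-parent r h y rest) (childOf-asym h y))

  fresh-child-upwards : (c : ℕ) (h : Vertex) (rest : List Vertex) → All ((c ∷ h) ⊑_) rest → ∀ y →
    (childOf h y ∧ notIn y (h ∷ (c ∷ h) ∷ rest)) ≡ (childOf h y ∧ not (y ==ᵥ (c ∷ h)))
  fresh-child-upwards c h rest below y with childOf h y in e
  ... | false = refl
  ... | true with c′ , refl ← childOf⇒∷ h y e =
    trans (cong (λ b → not b ∧ (not ((c′ ∷ h) ==ᵥ (c ∷ h)) ∧ notIn (c′ ∷ h) rest)) (==ᵥ-false (∷≢ c′ h)))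
          (∧-implied (not ((c′ ∷ h) ==ᵥ (c ∷ h))) (notIn (c′ ∷ h) rest)
             (λ ne → notIn⁺ (All.map (λ s eq → not-==ᵥ⇒≢ ne (⊑-length-≡ (subst ((c ∷ h) ⊑_) (sym eq) s) refl))
                                     below)))

  count-fresh-children : (h : Vertex) (rest : List Vertex) → Shape (h ∷ rest) → All InTree (h ∷ rest) →
    countᵇ (λ y → childOf h y ∧ notIn y (h ∷ rest)) V ≡ freshChildren (arrival (h ∷ rest)) (length h)
  count-fresh-children h [] _ (h∈ ∷ _) =
    trans (countᵇ-cong V (λ y → ∧-implied (childOf h y) _ (child-fresh y))) (count-children h h∈)
    where
    child-fresh : ∀ y → childOf h y ≡ true → notIn y (h ∷ []) ≡ true
    child-fresh y e with c , refl ← childOf⇒∷ h y e = notIn⁺ (∷≢ c h ∷ [])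
  count-fresh-children h (_ ∷ rest) (inj₁ ((c , refl) , below)) (h∈ ∷ ch∈ ∷ _) = begin
    countᵇ (λ y → childOf h y ∧ notIn y (h ∷ (c ∷ h) ∷ rest)) V
      ≡⟨ countᵇ-cong V (fresh-child-upwards c h rest below) ⟩
    countᵇ (λ y → childOf h y ∧ not (y ==ᵥ (c ∷ h))) V
      ≡⟨ sym (m+n∸n≡m _ 1) ⟩
    countᵇ (λ y → childOf h y ∧ not (y ==ᵥ (c ∷ h))) V + 1 ∸ 1
      ≡⟨ cong (λ m → countᵇ (λ y → childOf h y ∧ not (y ==ᵥ (c ∷ h))) V + m ∸ 1)
              (sym (occurs-once (c ∷ h) ch∈)) ⟩
    countᵇ (λ y → childOf h y ∧ not (y ==ᵥ (c ∷ h))) V + countᵇ (_==ᵥ (c ∷ h)) V ∸ 1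
      ≡⟨ cong (_∸ 1) (countᵇ-∖ (childOf h) (_==ᵥ (c ∷ h)) V c∷h-child) ⟩
    countᵇ (childOf h) V ∸ 1
      ≡⟨ cong (_∸ 1) (count-children h h∈) ⟩
    childCount (length h) ∸ 1
      ≡⟨ cong (λ a → freshChildren a (length h)) (sym (arrival-upwards c h rest)) ⟩
    freshChildren (arrival (h ∷ (c ∷ h) ∷ rest)) (length h) ∎
    where
    open ≡-Reasoning
    c∷h-child : ∀ y → (y ==ᵥ (c ∷ h)) ≡ true → childOf h y ≡ true
    c∷h-child y e with refl ← ==ᵥ⇒≡ {y} {c ∷ h} e = ==ᵥ-refl h
  count-fresh-children (c ∷ x) (x ∷ rest) (inj₂ ((c , refl) , notBelow)) (h∈ ∷ _) =
    trans (countᵇ-cong V (λ y → ∧-implied (childOf (c ∷ x) y) _ (child-fresh y)))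
          (trans (count-children (c ∷ x) h∈)
                 (cong (λ a → freshChildren a (length (c ∷ x))) (sym (arrival-downwards c x rest))))
    where
    child-fresh : ∀ y → childOf (c ∷ x) y ≡ true → notIn y ((c ∷ x) ∷ x ∷ rest) ≡ true
    child-fresh y e with c′ , refl ← childOf⇒∷ (c ∷ x) y e =
      notIn⁺ (∷≢ c′ (c ∷ x)
              ∷ All.map (λ ¬s eq → ¬s (subst ((c ∷ x) ⊑_) eq (⊑-∷ c′ (⊑-refl (c ∷ x))))) notBelow)

  count-fresh-parents : (h : Vertex) (rest : List Vertex) → Shape (h ∷ rest) → All InTree (h ∷ rest) →
    countᵇ (λ y → childOf y h ∧ notIn y (h ∷ rest)) V ≡ freshParents (arrival (h ∷ rest)) (length h)
  count-fresh-parents h [] _ (h∈ ∷ _) =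
    trans (countᵇ-cong V (λ y → ∧-implied (childOf y h) _ (parent-fresh y))) (count-parents h h∈)
    where
    parent-fresh : ∀ y → childOf y h ≡ true → notIn y (h ∷ []) ≡ true
    parent-fresh y e with c , refl ← childOf⇒∷ y h e = notIn⁺ ((∷≢ c y ∘ sym) ∷ [])
  count-fresh-parents h (_ ∷ rest) (inj₁ ((c , refl) , below)) (h∈ ∷ _) =
    trans (countᵇ-cong V (λ y → ∧-implied (childOf y h) _ (parent-fresh y)))
          (trans (count-parents h h∈) (cong (λ a → freshParents a (length h)) (sym (arrival-upwards c h rest))))
    where
    parent-fresh : ∀ y → childOf y h ≡ true → notIn y (h ∷ (c ∷ h) ∷ rest) ≡ true
    parent-fresh y e with c′ , refl ← childOf⇒∷ y h e =
      notIn⁺ ((∷≢ c′ y ∘ sym) ∷ (λ eq → <⇒≢ (≤-trans (n<1+n (length y)) (n≤1+n _)) (cong length eq))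
              ∷ All.map (λ s eq → 1+n≰n (≤-trans (n≤1+n _)
                                           (subst (λ z → length (c ∷ c′ ∷ y) ≤ length z) (sym eq) (⊑-length s))))
                        below)
  count-fresh-parents (c ∷ x) (x ∷ rest) (inj₂ ((c , refl) , _)) _ =
    trans (countᵇ-cong V parent-visited)
          (trans (countᵇ-false V) (cong (λ a → freshParents a (length (c ∷ x))) (sym (arrival-downwards c x rest))))
    where
    parent-visited : ∀ y → (childOf y (c ∷ x) ∧ notIn y ((c ∷ x) ∷ x ∷ rest)) ≡ false
    parent-visited y with x ==ᵥ y in e
    ... | false = refl
    ... | true with refl ← ==ᵥ⇒≡ {x} {y} e = notIn-∷-∷ x (c ∷ x) rest

  extension-sum : (r : ℕ) (p : List Vertex) → TreePath p →
    sumBy (λ y → if isOrientedPath (y ∷ p) then extensions r (y ∷ p) else 0) V ≡ extensions (suc r) p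
  extension-sum r (h ∷ rest) (path , shape , inTree) = begin
    sumBy (λ y → if isOrientedPath (y ∷ h ∷ rest) then extensions r (y ∷ h ∷ rest) else 0) V
      ≡⟨ sumBy-cong V (extension-split r h rest path) ⟩
    sumBy (λ y → (if child y then D else 0) + (if parent y then U else 0)) V
      ≡⟨ sumBy-+ (λ y → if child y then D else 0) (λ y → if parent y then U else 0) V ⟩
    sumBy (λ y → if child y then D else 0) V + sumBy (λ y → if parent y then U else 0) V
      ≡⟨ cong₂ _+_ (sumBy-if D child V) (sumBy-if U parent V) ⟩
    D * countᵇ child V + U * countᵇ parent V
      ≡⟨ cong₂ (λ a b → D * a + U * b) (count-fresh-children h rest shape inTree)
                                       (count-fresh-parents h rest shape inTree) ⟩
    D * freshChildren a (length h) + U * freshParents a (length h)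
      ≡⟨ cong₂ _+_ (*-comm D _) (*-comm U _) ⟩
    freshChildren a (length h) * D + freshParents a (length h) * U
      ≡⟨ sym (walks-suc r a (length h)) ⟩
    extensions (suc r) (h ∷ rest) ∎
    where
    open ≡-Reasoning
    a = arrival (h ∷ rest)
    D = walks r fromParent (suc (length h))
    U = walks r fromChild (pred (length h))
    child parent : Vertex → Bool
    child  y = childOf h y ∧ notIn y (h ∷ rest)
    parent y = childOf y h ∧ notIn y (h ∷ rest)

  pathsOfLength : ℕ → List (List Vertex)
  pathsOfLength m = filterᵇ isOrientedPath (sequences (suc m) V)

  pathExtensions : List Vertex → List (List Vertex)
  pathExtensions p = filterᵇ isOrientedPath (map (_∷ p) V)

  pathExtensions-nonPath : ∀ p → isOrientedPath p ≡ false → pathExtensions p ≡ []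
  pathExtensions-nonPath p nonPath = filter-none (T? ∘ isOrientedPath) (map⁺ (All.universal nonPath-∷ V))
    where
    nonPath-∷ : ∀ y → ¬ T (isOrientedPath (y ∷ p))
    nonPath-∷ y t with () ← trans (sym nonPath) (isOrientedPath-tail y p (Equivalence.to T-≡ t))

  pathsOfLength-zero : pathsOfLength 0 ≡ pathExtensions [] ++ []
  pathsOfLength-zero = filter-++ (T? ∘ isOrientedPath) (map (_∷ []) V) []

  pathsOfLength-suc : ∀ m → pathsOfLength (suc m) ≡ concatMap pathExtensions (pathsOfLength m)
  pathsOfLength-suc m =
    trans (filterᵇ-concatMap isOrientedPath (λ p → map (_∷ p) V) (sequences (suc m) V))
          (concatMap-filterᵇ pathExtensions isOrientedPath (sequences (suc m) V) pathExtensions-nonPath)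

  sumBy-pathExtensions : (f : List Vertex → ℕ) (p : List Vertex) →
    sumBy f (pathExtensions p) ≡ sumBy (λ y → if isOrientedPath (y ∷ p) then f (y ∷ p) else 0) V
  sumBy-pathExtensions f p =
    trans (sumBy-filterᵇ f isOrientedPath (map (_∷ p) V))
          (sumBy-map (λ q → if isOrientedPath q then f q else 0) (_∷ p) V)

  TreePath-pathExtensions : (p : List Vertex) →
    (∀ y → InTree y → isOrientedPath (y ∷ p) ≡ true → TreePath (y ∷ p)) →
    (ys : List Vertex) → All InTree ys → All TreePath (filterᵇ isOrientedPath (map (_∷ p) ys))
  TreePath-pathExtensions p extend []       []         = []
  TreePath-pathExtensions p extend (y ∷ ys) (y∈ ∷ ys∈) with isOrientedPath (y ∷ p) in path
  ... | true  = extend y y∈ path ∷ TreePath-pathExtensions p extend ys ys∈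
  ... | false = TreePath-pathExtensions p extend ys ys∈

  all-TreePath : ∀ m → All TreePath (pathsOfLength m)
  all-TreePath zero    = subst (All TreePath) (sym pathsOfLength-zero)
    (++⁺ (TreePath-pathExtensions [] (λ y y∈ path → path , tt , y∈ ∷ []) V all-InTree) [])
  all-TreePath (suc m) = subst (All TreePath) (sym (pathsOfLength-suc m))
    (concat⁺ (map⁺ (All.map (λ {p} p-tree → TreePath-pathExtensions p (λ y → TreePath-extend y p p-tree) V all-InTree)
                            (all-TreePath m))))

  sumBy-extensions : ∀ m r → sumBy (extensions r) (pathsOfLength m) ≡ sumBy (λ v → walks (r + m) start (length v)) V
  sumBy-extensions zero    r = begin
    sumBy (extensions r) (pathsOfLength 0)
      ≡⟨ cong (sumBy (extensions r)) pathsOfLength-zero ⟩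
    sumBy (extensions r) (pathExtensions [] ++ [])
      ≡⟨ sumBy-++ (extensions r) (pathExtensions []) [] ⟩
    sumBy (extensions r) (pathExtensions []) + 0
      ≡⟨ +-identityʳ _ ⟩
    sumBy (extensions r) (pathExtensions [])
      ≡⟨ sumBy-pathExtensions (extensions r) [] ⟩
    sumBy (λ v → walks r start (length v)) V
      ≡⟨ cong (λ t → sumBy (λ v → walks t start (length v)) V) (sym (+-identityʳ r)) ⟩
    sumBy (λ v → walks (r + 0) start (length v)) V ∎
    where open ≡-Reasoning
  sumBy-extensions (suc m) r = begin
    sumBy (extensions r) (pathsOfLength (suc m))
      ≡⟨ cong (sumBy (extensions r)) (pathsOfLength-suc m) ⟩
    sumBy (extensions r) (concatMap pathExtensions (pathsOfLength m))
      ≡⟨ sumBy-concatMap (extensions r) pathExtensions (pathsOfLength m) ⟩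
    sumBy (sumBy (extensions r) ∘ pathExtensions) (pathsOfLength m)
      ≡⟨ sumBy-congᴬ (All.map (λ {p} p-tree → trans (sumBy-pathExtensions (extensions r) p) (extension-sum r p p-tree))
                              (all-TreePath m)) ⟩
    sumBy (extensions (suc r)) (pathsOfLength m)
      ≡⟨ sumBy-extensions m (suc r) ⟩
    sumBy (λ v → walks (suc r + m) start (length v)) V
      ≡⟨ cong (λ t → sumBy (λ v → walks t start (length v)) V) (sym (+-suc r m)) ⟩
    sumBy (λ v → walks (r + suc m) start (length v)) V ∎
    where open ≡-Reasoning

  orientedPaths≡sumBy-walks : ∀ ℓ → orientedPaths n k ℓ ≡ sumBy (λ v → walks ℓ start (length v)) V
  -- extensions 0 is constantly 1, so its sum over the paths is their number.
  orientedPaths≡sumBy-walks ℓ = trans (sym (countᵇ-true (pathsOfLength ℓ))) (sumBy-extensions ℓ 0)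

-- Evaluating the walk counts

module Counting (p : ℕ) where

  q k : ℕ
  q = suc p
  k = suc q

  W : ℕ → ℕ → Arrival → ℕ → ℕ
  W n = Dendrimer.walks n k

  childCount : ℕ → ℕ → ℕ
  childCount n = Dendrimer.childCount n k

  childCount-inner : ∀ {n d} → d < n → childCount n d ≡ Levels.branching k d
  childCount-inner {n} {d} d<n = cong (λ b → if b then Levels.branching k d else 0) (<ᵇ-true d<n)

  childCount-outer : ∀ {n d} → n ≤ d → childCount n d ≡ 0
  childCount-outer {n} {d} n≤d = cong (λ b → if b then Levels.branching k d else 0) (<ᵇ-false n≤d)

  descending-shift : ∀ n r d → W (suc n) r fromParent (suc (suc d)) ≡ W n r fromParent (suc d)
  descending-shift n zero    d = refl
  descending-shift n (suc r) d = cong (childCount n (suc d) *_) (descending-shift n r (suc d))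

  descending-complete : ∀ n r d → suc d + r ≤ n → W n r fromParent (suc d) ≡ q ^ r
  descending-complete n zero    d _     = refl
  descending-complete n (suc r) d d+r≤n = cong₂ _*_
    (childCount-inner (≤-trans (m<m+n (suc d) (s≤s z≤n)) d+r≤n))
    (descending-complete n r (suc d) (≤-trans (≤-reflexive (sym (+-suc (suc d) r))) d+r≤n))

  descending-blocked : ∀ n r d → d ≤ n → n < d + r → W n r fromParent d ≡ 0
  descending-blocked n zero    d d≤n n<d+0 = ⊥-elim (<⇒≱ n<d+0 (subst (_≤ n) (sym (+-identityʳ d)) d≤n))
  descending-blocked n (suc r) d d≤n n<d+r with m≤n⇒m<n∨m≡n d≤n
  ... | inj₁ d<n  = trans (cong (childCount n d *_) (descending-blocked n r (suc d) d<n (subst (n <_) (+-suc d r) n<d+r)))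
                          (*-zeroʳ (childCount n d))
  ... | inj₂ refl = cong (_* W n r fromParent (suc d)) (childCount-outer {n} ≤-refl)

  ascending-blocked : ∀ n r d → d < n → n + d < r → W n r fromChild d ≡ 0
  ascending-blocked n (suc r) zero    0<n n+0<r =
    trans (+-identityʳ _)
      (trans (cong ((childCount n 0 ∸ 1) *_) (descending-blocked n r 1 0<n (subst (_< suc r) (+-identityʳ n) n+0<r)))
             (*-zeroʳ (childCount n 0 ∸ 1)))
  ascending-blocked n (suc r) (suc d) d<n n+d<r = begin
    (childCount n (suc d) ∸ 1) * W n r fromParent (suc (suc d)) + 1 * W n r fromChild d
      ≡⟨ cong₂ (λ x y → (childCount n (suc d) ∸ 1) * x + 1 * y)
               (descending-blocked n r (suc (suc d)) d<n (s≤s (≤-trans n≤r (m≤n+m r (suc d)))))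
               (ascending-blocked n r d (<-trans (n<1+n d) d<n) (subst (_≤ r) (+-suc n d) (≤-pred n+d<r))) ⟩
    (childCount n (suc d) ∸ 1) * 0 + 0
      ≡⟨ trans (+-identityʳ _) (*-zeroʳ (childCount n (suc d) ∸ 1)) ⟩
    0 ∎
    where
    open ≡-Reasoning
    n≤r : n ≤ r
    n≤r = ≤-trans (m≤m+n n (suc d)) (≤-pred n+d<r)

  ascending-root : ∀ n r → r ≤ suc n → W (suc n) r fromChild 0 ≡ q ^ r
  ascending-root n zero    _       = refl
  ascending-root n (suc r) r<n+1 = trans (+-identityʳ _) (cong (q *_) (descending-complete (suc n) r 0 r<n+1))

  ascending-root-blocked : ∀ n r → suc n ≤ r → W (suc n) (suc r) fromChild 0 ≡ 0
  ascending-root-blocked n r n<r =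
    trans (+-identityʳ _) (trans (cong (q *_) (descending-blocked (suc n) r 1 (s≤s z≤n) (s≤s n<r))) (*-zeroʳ q))

  -- Upward walks of length r from depth d in T_{n+1} outnumber those from depth d − 1 in T_n by the
  -- number of walks that cross the root of T_{n+1} and end at depth n (r = d + n) or n + 1 (r = d + n + 1).
  rootCorrection : ℕ → ℕ → ℕ → ℕ
  rootCorrection n d r = if r ≡ᵇ d + n then q ^ n else if r ≡ᵇ suc (d + n) then q ^ suc n else 0

  private
    lower : ℕ → ℕ → ℕ → ℕ
    lower n d r = if r ≡ᵇ suc (d + n) then q ^ suc n else 0

  rootCorrection-none : ∀ n d r → r ≢ d + n → r ≢ suc (d + n) → rootCorrection n d r ≡ 0
  rootCorrection-none n d r r≢ r≢′ =
    trans (cong (λ b → if b then q ^ n else lower n d r) (≡ᵇ-false r≢))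
          (cong (λ b → if b then q ^ suc n else 0) (≡ᵇ-false r≢′))

  rootCorrection-upper : ∀ n d r → r ≡ d + n → rootCorrection n d r ≡ q ^ n
  rootCorrection-upper n d r r≡ = cong (λ b → if b then q ^ n else lower n d r) (≡ᵇ-true r≡)

  rootCorrection-lower : ∀ n d r → r ≡ suc (d + n) → rootCorrection n d r ≡ q ^ suc n
  rootCorrection-lower n d _ refl =
    trans (cong (λ b → if b then q ^ n else lower n d (suc (d + n))) (≡ᵇ-false (1+n≢n {d + n})))
          (cong (λ b → if b then q ^ suc n else 0) (≡ᵇ-true {suc (d + n)} refl))

  ascending-root-shift : ∀ n r →
    W (suc (suc n)) (suc r) fromChild 1 ≡ W (suc n) (suc r) fromChild 0 + rootCorrection (suc n) 1 (suc r)
  ascending-root-shift n r = trans (cong (λ x → p * x + 1 * W (suc N) r fromChild 0) (descending-shift N r 0))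
                                   (by-cases r (<-cmp r N))
    where
    N = suc n
    Goal : ℕ → Set
    Goal r = p * W N r fromParent 1 + 1 * W (suc N) r fromChild 0
               ≡ (q * W N r fromParent 1 + 0) + rootCorrection N 1 (suc r)
    evaluate : ∀ r {x y c} →
      W N r fromParent 1 ≡ x → W (suc N) r fromChild 0 ≡ y → rootCorrection N 1 (suc r) ≡ c →
      p * x + 1 * y ≡ (q * x + 0) + c → Goal r
    evaluate r refl refl refl e = e
    inner : ∀ p x → p * x + 1 * x ≡ (suc p * x + 0) + 0
    inner = solve-∀
    beyond : ∀ p y → p * 0 + 1 * y ≡ (suc p * 0 + 0) + y
    beyond = solve-∀
    by-cases : ∀ r → Tri (r < N) (r ≡ N) (N < r) → Goal r
    by-cases r (tri< r<N _ _) =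
      evaluate r (descending-complete N r 0 r<N) (ascending-root N r (≤-trans (<⇒≤ r<N) (n≤1+n N)))
               (rootCorrection-none N 1 (suc r) (<⇒≢ (s≤s r<N)) (<⇒≢ (s≤s (≤-trans r<N (n≤1+n N)))))
               (inner p (q ^ r))
    by-cases r (tri≈ _ refl _) =
      evaluate N (descending-blocked N N 1 (s≤s z≤n) ≤-refl) (ascending-root N N (n≤1+n N))
               (rootCorrection-upper N 1 (suc N) refl)
               (beyond p (q ^ N))
    by-cases (suc r) (tri> _ _ (s≤s N≤r)) with m≤n⇒m<n∨m≡n N≤r
    ... | inj₂ refl =
      evaluate (suc N) (descending-blocked N (suc N) 1 (s≤s z≤n) (n≤1+n (suc N))) (ascending-root N (suc N) ≤-refl)
               (rootCorrection-lower N 1 (suc (suc N)) refl) (beyond p (q ^ suc N))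
    ... | inj₁ N<r =
      evaluate (suc r) (descending-blocked N (suc r) 1 (s≤s z≤n) (s≤s (≤-trans (<⇒≤ N<r) (n≤1+n r))))
               (ascending-root-blocked N r N<r)
               (rootCorrection-none N 1 (suc (suc r)) (>⇒≢ (s≤s (s≤s (<⇒≤ N<r)))) (>⇒≢ (s≤s (s≤s N<r))))
               (beyond p 0)

  private
    regroup : ∀ a x y c → a * x + 1 * (y + c) ≡ (a * x + 1 * y) + c
    regroup = solve-∀

  ascending-shift : ∀ n d → d < n → ∀ r →
    W (suc n) r fromChild (suc d) ≡ W n r fromChild d + rootCorrection n (suc d) r
  ascending-shift n       d       _   zero    = refl
  ascending-shift (suc n) zero    _   (suc r) = ascending-root-shift n r
  ascending-shift n       (suc d) d<n (suc r) =
    trans (cong₂ (λ x y → (childCount n (suc d) ∸ 1) * x + 1 * y)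
                 (descending-shift n r (suc d)) (ascending-shift n d (<-trans (n<1+n d) d<n) r))
          (regroup (childCount n (suc d) ∸ 1) _ _ _)

  start-shift : ∀ n d → d < n → ∀ r →
    W (suc n) (suc r) start (suc (suc d)) ≡ W n (suc r) start (suc d) + rootCorrection n (suc d) r
  start-shift n d d<n r =
    trans (cong₂ (λ x y → childCount n (suc d) * x + 1 * y) (descending-shift n r (suc d)) (ascending-shift n d d<n r))
          (regroup (childCount n (suc d)) _ _ _)

  ascending-longest : ∀ n d → d < n → W n (n + d) fromChild d ≡ q ^ n
  ascending-longest (suc n) zero    _   =
    trans (cong (λ r → W (suc n) r fromChild 0) (+-identityʳ (suc n))) (ascending-root n (suc n) ≤-refl)
  ascending-longest n       (suc d) d<n = begin
    W n (n + suc d) fromChild (suc d)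
      ≡⟨ cong (λ r → W n r fromChild (suc d)) (+-suc n d) ⟩
    (childCount n (suc d) ∸ 1) * W n (n + d) fromParent (suc (suc d)) + 1 * W n (n + d) fromChild d
      ≡⟨ cong₂ (λ x y → (childCount n (suc d) ∸ 1) * x + 1 * y)
               (descending-blocked n (n + d) (suc (suc d)) d<n (s≤s (≤-trans (m≤m+n n d) (m≤n+m (n + d) (suc d)))))
               (ascending-longest n d (<-trans (n<1+n d) d<n)) ⟩
    (childCount n (suc d) ∸ 1) * 0 + 1 * q ^ n
      ≡⟨ trans (cong (_+ 1 * q ^ n) (*-zeroʳ (childCount n (suc d) ∸ 1))) (+-identityʳ (q ^ n)) ⟩
    q ^ n ∎
    where open ≡-Reasoning

  start-blocked : ∀ n r d → d ≤ n → n + d ≤ r → W n (suc r) start d ≡ 0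
  start-blocked n r zero    _   n+0≤r =
    trans (+-identityʳ _) (descending-blocked n (suc r) 0 z≤n (s≤s (subst (_≤ r) (+-identityʳ n) n+0≤r)))
  start-blocked n r (suc d) d<n n+d<r = cong₂ (λ x y → x + 1 * y)
    (descending-blocked n (suc r) (suc d) d<n
      (s≤s (≤-trans (m≤m+n n (suc d)) (≤-trans n+d<r (≤-trans (n≤1+n r) (m≤n+m (suc r) d))))))
    (ascending-blocked n r d d<n (subst (_≤ r) (+-suc n d) n+d<r))

  levelSize : ℕ → ℕ
  levelSize d = length (level k d)

  levelSize-one : levelSize 1 ≡ k
  levelSize-one = trans (length-map (_∷ []) (upTo k)) (length-upTo k)

  levelSize-suc-suc : ∀ d → levelSize (suc (suc d)) ≡ q * levelSize (suc d)
  levelSize-suc-suc d = begin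
    levelSize (suc (suc d))
      ≡⟨ sym (countᵇ-true (level k (suc (suc d)))) ⟩
    countᵇ (λ _ → true) (level k (suc (suc d)))
      ≡⟨ Levels.sumBy-level-suc k d (λ _ → 1) ⟩
    sumBy (λ _ → countᵇ (λ _ → true) (upTo q)) (level k (suc d))
      ≡⟨ sumBy-cong (level k (suc d)) (λ _ → trans (countᵇ-true (upTo q)) (length-upTo q)) ⟩
    sumBy (λ _ → q) (level k (suc d))
      ≡⟨ trans (sumBy-const q (level k (suc d))) (*-comm (levelSize (suc d)) q) ⟩
    q * levelSize (suc d) ∎
    where open ≡-Reasoning

  levelSize-suc : ∀ d → levelSize (suc d) ≡ k * q ^ d
  levelSize-suc zero    = trans levelSize-one (sym (*-identityʳ k))
  levelSize-suc (suc d) = trans (levelSize-suc-suc d) (trans (cong (q *_) (levelSize-suc d)) (x*[y*z]≡y*[x*z] q k (q ^ d)))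
    where
    x*[y*z]≡y*[x*z] : ∀ x y z → x * (y * z) ≡ y * (x * z)
    x*[y*z]≡y*[x*z] = solve-∀

  sumBy-level : ∀ d (f : ℕ → ℕ) → sumBy (f ∘ length) (level k d) ≡ levelSize d * f d
  sumBy-level d f =
    trans (sumBy-congᴬ (All.map (λ (l , _) → cong f l) (Levels.level-sound k d))) (sumBy-const (f d) (level k d))

  sumBy-vertices : ∀ N (f : ℕ → ℕ) →
    sumBy (f ∘ length) (vertices N k) ≡ f 0 + ∑₁ N (λ d → levelSize d * f d)
  sumBy-vertices zero    f = refl
  sumBy-vertices (suc N) f =
    trans (sumBy-++ (f ∘ length) (vertices N k) (level k (suc N)))
          (trans (cong₂ _+_ (sumBy-vertices N f) (sumBy-level (suc N) f)) (+-assoc (f 0) _ _))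

  interior : ℕ → ℕ → ℕ
  interior n ℓ = ∑₁ n (λ d → levelSize d * W n ℓ start d)

  total : ℕ → ℕ → ℕ
  total n ℓ = W n ℓ start 0 + interior n ℓ

  orientedPaths≡total : ∀ n ℓ → orientedPaths n k ℓ ≡ total n ℓ
  orientedPaths≡total n ℓ = trans (Dendrimer.orientedPaths≡sumBy-walks n k ℓ) (sumBy-vertices n (W n ℓ start))

  rootCorrections : ℕ → ℕ → ℕ
  rootCorrections n r = ∑₁ n (λ d → levelSize d * rootCorrection n d r)

  total-suc : ∀ n r → total (suc n) (suc r) ≡
    W (suc n) (suc r) start 0 + (k * W (suc n) (suc r) start 1 + (q * interior n (suc r) + q * rootCorrections n r))
  total-suc n r = cong (W (suc n) (suc r) start 0 +_) (begin
    ∑₁ (suc n) (λ d → levelSize d * W (suc n) (suc r) start d)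
      ≡⟨ ∑₁-suc n _ ⟩
    levelSize 1 * W (suc n) (suc r) start 1 + ∑₁ n (λ d → levelSize (suc d) * W (suc n) (suc r) start (suc d))
      ≡⟨ cong₂ _+_ (cong (_* W (suc n) (suc r) start 1) levelSize-one) (∑₁-cong n shifted) ⟩
    k * W (suc n) (suc r) start 1
      + ∑₁ n (λ d → q * (levelSize d * W n (suc r) start d) + q * (levelSize d * rootCorrection n d r))
      ≡⟨ cong (k * W (suc n) (suc r) start 1 +_) (trans (∑₁-+ n _ _) (cong₂ _+_ (∑₁-*ˡ n q _) (∑₁-*ˡ n q _))) ⟩
    k * W (suc n) (suc r) start 1 + (q * interior n (suc r) + q * rootCorrections n r) ∎)
    where
    open ≡-Reasoning
    distrib : ∀ q a x c → q * a * (x + c) ≡ q * (a * x) + q * (a * c)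
    distrib = solve-∀
    shifted : ∀ d → 1 ≤ d → d ≤ n →
      levelSize (suc d) * W (suc n) (suc r) start (suc d)
        ≡ q * (levelSize d * W n (suc r) start d) + q * (levelSize d * rootCorrection n d r)
    shifted (suc d) _ d<n =
      trans (cong₂ _*_ (levelSize-suc-suc d) (start-shift n d d<n r)) (distrib q (levelSize (suc d)) _ _)

  start-root : ∀ n r → r < n → W n (suc r) start 0 ≡ k * q ^ r
  start-root n r r<n =
    trans (+-identityʳ _) (cong₂ _*_ (childCount-inner (≤-trans (s≤s z≤n) r<n)) (descending-complete n r 0 r<n))

  start-one : ∀ n r →
    W (suc n) (suc r) start 1 ≡ childCount (suc n) 1 * W n r fromParent 1 + 1 * W (suc n) r fromChild 0
  start-one n r = cong (λ x → childCount (suc n) 1 * x + 1 * W (suc n) r fromChild 0) (descending-shift n r 0)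

  descending-one-blocked : ∀ n r → n ≤ r → childCount (suc n) 1 * W n r fromParent 1 ≡ 0
  descending-one-blocked zero    r _   = refl
  descending-one-blocked (suc n) r n≤r =
    trans (cong (q *_) (descending-blocked (suc n) r 1 (s≤s z≤n) (s≤s n≤r))) (*-zeroʳ q)

  rootCorrections-short : ∀ n r → r ≤ n → rootCorrections n r ≡ 0
  rootCorrections-short n r r≤n = ∑₁-zero n _ (λ d 1≤d _ → trans
    (cong (levelSize d *_) (rootCorrection-none n d r (<⇒≢ (short d 1≤d)) (<⇒≢ (≤-trans (short d 1≤d) (n≤1+n _)))))
    (*-zeroʳ (levelSize d)))
    where
    short : ∀ d → 1 ≤ d → r < d + n
    short d 1≤d = ≤-trans (s≤s r≤n) (+-monoˡ-≤ n 1≤d)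

  rootCorrections-next : ∀ n → 1 ≤ n → rootCorrections n (suc n) ≡ k * q ^ n
  rootCorrections-next (suc n) _ = begin
    rootCorrections N (suc N)
      ≡⟨ ∑₁-suc n _ ⟩
    levelSize 1 * rootCorrection N 1 (suc N) + ∑₁ n (λ d → levelSize (suc d) * rootCorrection N (suc d) (suc N))
      ≡⟨ cong₂ _+_ (cong₂ _*_ levelSize-one (rootCorrection-upper N 1 (suc N) refl)) (∑₁-zero n _ deeper) ⟩
    k * q ^ N + 0
      ≡⟨ +-identityʳ _ ⟩
    k * q ^ N ∎
    where
    open ≡-Reasoning
    N = suc n
    deeper : ∀ d → 1 ≤ d → d ≤ n → levelSize (suc d) * rootCorrection N (suc d) (suc N) ≡ 0
    deeper d 1≤d _ = trans
      (cong (levelSize (suc d) *_) (rootCorrection-none N (suc d) (suc N)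
        (<⇒≢ (s≤s (+-monoˡ-≤ N 1≤d))) (<⇒≢ (≤-trans (s≤s (+-monoˡ-≤ N 1≤d)) (n≤1+n _)))))
      (*-zeroʳ (levelSize (suc d)))

  rootCorrections-far : ∀ n t → suc (suc t) ≤ n → rootCorrections n (suc (suc (n + t))) ≡ 2 * k * q ^ suc (n + t)
  rootCorrections-far n t t+2≤n = begin
    ∑₁ n f
      ≡⟨ cong (λ N → ∑₁ N f) (sym (m+[n∸m]≡n t+2≤n)) ⟩
    ∑₁ (suc (suc t) + u) f
      ≡⟨ ∑₁-+-split (suc (suc t)) u f ⟩
    ((∑₁ t f + f (suc t)) + f (suc (suc t))) + ∑₁ u (λ d → f (suc (suc t) + d))
      ≡⟨ cong₂ _+_ (cong₂ _+_ (cong₂ _+_ (∑₁-zero t f shallower)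
                                       (cong₂ _*_ (levelSize-suc t) (rootCorrection-lower n (suc t) r r≡)))
                             (cong₂ _*_ (levelSize-suc (suc t)) (rootCorrection-upper n (suc (suc t)) r r≡)))
                   (∑₁-zero u _ deeper) ⟩
    ((0 + k * q ^ t * q ^ suc n) + k * q ^ suc t * q ^ n) + 0
      ≡⟨ trans (collect k q (q ^ t) (q ^ n)) (cong (λ x → 2 * k * (q * x)) (sym (^-distribˡ-+-* q n t))) ⟩
    2 * k * q ^ suc (n + t) ∎
    where
    open ≡-Reasoning
    r = suc (suc (n + t))
    u = n ∸ suc (suc t)
    r≡ : r ≡ suc (suc (t + n))
    r≡ = cong (suc ∘ suc) (+-comm n t)
    f : ℕ → ℕ
    f d = levelSize d * rootCorrection n d r
    collect : ∀ k q a b → ((0 + k * a * (q * b)) + k * (q * a) * b) + 0 ≡ 2 * k * (q * (b * a))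
    collect = solve-∀
    r>d+n : ∀ d → d ≤ t → r > suc (d + n)
    r>d+n d d≤t = s≤s (s≤s (≤-trans (+-monoˡ-≤ n d≤t) (≤-reflexive (+-comm t n))))
    shallower : ∀ d → 1 ≤ d → d ≤ t → f d ≡ 0
    shallower d _ d≤t = trans (cong (levelSize d *_)
      (rootCorrection-none n d r (>⇒≢ (≤-trans (n≤1+n _) (r>d+n d d≤t))) (>⇒≢ (r>d+n d d≤t))))
      (*-zeroʳ (levelSize d))
    r<d+n : ∀ d → 1 ≤ d → r < suc (suc t) + d + n
    r<d+n d 1≤d = s≤s (s≤s (≤-trans (≤-reflexive (cong suc (+-comm n t))) (+-monoˡ-< n (m<m+n t 1≤d))))
    deeper : ∀ d → 1 ≤ d → d ≤ u → f (suc (suc t) + d) ≡ 0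
    deeper d 1≤d _ = trans (cong (levelSize (suc (suc t) + d) *_) (rootCorrection-none n (suc (suc t) + d) r
      (<⇒≢ (r<d+n d 1≤d)) (<⇒≢ (≤-trans (r<d+n d 1≤d) (n≤1+n _)))))
      (*-zeroʳ (levelSize (suc (suc t) + d)))

  Boundary : ℕ → ℕ → Set
  Boundary n r = W (suc n) (suc r) start 0 + k * W (suc n) (suc r) start 1 + q * rootCorrections n r
                   ≡ q * W n (suc r) start 0 + 2 * k * q ^ r

  private
    Boundary-from : ∀ n r {s₀ s₁ z c} →
      W (suc n) (suc r) start 0 ≡ s₀ → W (suc n) (suc r) start 1 ≡ s₁ → W n (suc r) start 0 ≡ z →
      rootCorrections n r ≡ c → s₀ + k * s₁ + q * c ≡ q * z + 2 * k * q ^ r → Boundary n r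
    Boundary-from n r refl refl refl refl e = e

    start-one-≡ : ∀ n r {x y} → childCount (suc n) 1 * W n r fromParent 1 ≡ x → W (suc n) r fromChild 0 ≡ y →
      W (suc n) (suc r) start 1 ≡ x + 1 * y
    start-one-≡ n r refl refl = start-one n r

  Boundary-below : ∀ n r → r < n → Boundary n r
  Boundary-below n r r<n = Boundary-from n r
    (start-root (suc n) r (≤-trans r<n (n≤1+n n)))
    (start-one-≡ n r (cong₂ _*_ (childCount-inner (s≤s (≤-trans (s≤s z≤n) r<n))) (descending-complete n r 0 r<n))
                     (ascending-root n r (≤-trans (<⇒≤ r<n) (n≤1+n n))))
    (start-root n r r<n) (rootCorrections-short n r (<⇒≤ r<n)) (collect k q (q ^ r))
    where
    collect : ∀ k q x → k * x + k * (q * x + 1 * x) + q * 0 ≡ q * (k * x) + 2 * k * x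
    collect = solve-∀

  Boundary-at : ∀ n → Boundary n n
  Boundary-at n = Boundary-from n n
    (start-root (suc n) n (n<1+n n))
    (start-one-≡ n n (descending-one-blocked n n ≤-refl) (ascending-root n n (n≤1+n n)))
    (start-blocked n n 0 z≤n (≤-reflexive (+-identityʳ n))) (rootCorrections-short n n ≤-refl) (collect k q (q ^ n))
    where
    collect : ∀ k q x → k * x + k * (0 + 1 * x) + q * 0 ≡ q * 0 + 2 * k * x
    collect = solve-∀

  Boundary-next : ∀ n → 1 ≤ n → Boundary n (suc n)
  Boundary-next n 1≤n = Boundary-from n (suc n)
    (start-blocked (suc n) (suc n) 0 z≤n (≤-reflexive (+-identityʳ (suc n))))
    (start-one-≡ n (suc n) (descending-one-blocked n (suc n) (n≤1+n n)) (ascending-root n (suc n) ≤-refl))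
    (start-blocked n (suc n) 0 z≤n (≤-trans (≤-reflexive (+-identityʳ n)) (n≤1+n n)))
    (rootCorrections-next n 1≤n) (collect k q (q ^ n))
    where
    collect : ∀ k q x → 0 + k * (0 + 1 * (q * x)) + q * (k * x) ≡ q * 0 + 2 * k * (q * x)
    collect = solve-∀

  Boundary-far : ∀ n t → suc (suc t) ≤ n → Boundary n (suc (suc (n + t)))
  Boundary-far n t t+2≤n = Boundary-from n r
    (start-blocked (suc n) r 0 z≤n (s≤s n+0≤r-1))
    (start-one-≡ n r (descending-one-blocked n r n≤r) (ascending-root-blocked n (suc (n + t)) (s≤s (m≤m+n n t))))
    (start-blocked n r 0 z≤n (≤-trans n+0≤r-1 (n≤1+n _)))
    (rootCorrections-far n t t+2≤n) (collect k q (q ^ suc (n + t)))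
    where
    r = suc (suc (n + t))
    n+0≤r-1 : n + 0 ≤ suc (n + t)
    n+0≤r-1 = ≤-trans (≤-reflexive (+-identityʳ n)) (≤-trans (m≤m+n n t) (n≤1+n _))
    n≤r : n ≤ r
    n≤r = ≤-trans (≤-reflexive (sym (+-identityʳ n))) (≤-trans n+0≤r-1 (n≤1+n _))
    collect : ∀ k q x → 0 + k * (0 + 1 * 0) + q * (2 * k * x) ≡ q * 0 + 2 * k * (q * x)
    collect = solve-∀

  boundary : ∀ n r → r ≤ 2 * n → Boundary n r
  boundary n r r≤2n with <-cmp r n
  ... | tri< r<n _ _ = Boundary-below n r r<n
  ... | tri≈ _ refl _ = Boundary-at n
  ... | tri> _ _ n<r with r | m≤n⇒m<n∨m≡n n<r
  ...   | suc r′ | inj₂ refl = Boundary-next n (positive n r≤2n)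
    where
    positive : ∀ n → suc n ≤ 2 * n → 1 ≤ n
    positive (suc n) _ = s≤s z≤n
  ...   | suc r′ | inj₁ (s≤s n<r′) with m≤n⇒∃[o]m+o≡n n<r′
  ...     | t , refl = Boundary-far n t (+-cancelˡ-≤ n (suc (suc t)) n (subst₂ _≤_ eq₁ eq₂ r≤2n))
    where
    eq₁ : suc (suc (n + t)) ≡ n + suc (suc t)
    eq₁ = sym (trans (+-suc n (suc t)) (cong suc (+-suc n t)))
    eq₂ : 2 * n ≡ n + n
    eq₂ = cong (n +_) (+-identityʳ n)

  total-step : ∀ n r → r ≤ 2 * n → total (suc n) (suc r) ≡ q * total n (suc r) + 2 * k * q ^ r
  total-step n r r≤2n = begin
    total (suc n) (suc r)
      ≡⟨ total-suc n r ⟩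
    s₀ + (k * s₁ + (q * interior n (suc r) + q * c))
      ≡⟨ move-interior s₀ (k * s₁) (q * interior n (suc r)) (q * c) ⟩
    (s₀ + k * s₁ + q * c) + q * interior n (suc r)
      ≡⟨ cong (_+ q * interior n (suc r)) (boundary n r r≤2n) ⟩
    (q * z + 2 * k * q ^ r) + q * interior n (suc r)
      ≡⟨ collect q z (interior n (suc r)) (2 * k * q ^ r) ⟩
    q * total n (suc r) + 2 * k * q ^ r ∎
    where
    open ≡-Reasoning
    s₀ = W (suc n) (suc r) start 0
    s₁ = W (suc n) (suc r) start 1
    z  = W n (suc r) start 0
    c  = rootCorrections n r
    move-interior : ∀ a b i c → a + (b + (i + c)) ≡ (a + b + c) + i
    move-interior = solve-∀
    collect : ∀ q z i e → (q * z + e) + q * i ≡ q * (z + i) + e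
    collect = solve-∀

  interior-blocked : ∀ n r N → N ≤ n → n + N ≤ r → ∑₁ N (λ d → levelSize d * W n (suc r) start d) ≡ 0
  interior-blocked n r N N≤n n+N≤r = ∑₁-zero N _ (λ d _ d≤N → trans
    (cong (levelSize d *_) (start-blocked n r d (≤-trans d≤N N≤n) (≤-trans (+-monoʳ-≤ n d≤N) n+N≤r)))
    (*-zeroʳ (levelSize d)))

  total-beyond : ∀ n r → 2 * n ≤ r → total n (suc r) ≡ 0
  total-beyond n r 2n≤r =
    cong₂ _+_ (start-blocked n r 0 z≤n (≤-trans (+-monoʳ-≤ n z≤n) n+n≤r)) (interior-blocked n r n ≤-refl n+n≤r)
    where
    n+n≤r : n + n ≤ r
    n+n≤r = subst (_≤ r) (cong (n +_) (+-identityʳ n)) 2n≤r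

  total-diameter : ∀ m → total (suc m) (suc (suc (2 * m))) ≡ k * q ^ suc (2 * m)
  total-diameter m = begin
    W (suc m) (suc r) start 0 + (∑₁ m f + f (suc m))
      ≡⟨ cong₂ (λ a b → a + (b + f (suc m)))
               (start-blocked (suc m) r 0 z≤n (s≤s (+-monoʳ-≤ m z≤n)))
               (interior-blocked (suc m) r m (n≤1+n m) (s≤s (+-monoʳ-≤ m (≤-reflexive (sym (+-identityʳ m)))))) ⟩
    levelSize (suc m) * W (suc m) (suc r) start (suc m)
      ≡⟨ cong₂ _*_ (levelSize-suc m) leaf ⟩
    k * q ^ m * q ^ suc m
      ≡⟨ collect k q (q ^ m) ⟩
    k * (q * (q ^ m * q ^ m))
      ≡⟨ cong (λ x → k * (q * x)) (sym (^-double q m)) ⟩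
    k * q ^ suc (2 * m) ∎
    where
    open ≡-Reasoning
    r = suc (2 * m)
    f : ℕ → ℕ
    f d = levelSize d * W (suc m) (suc r) start d
    collect : ∀ k q x → k * x * (q * x) ≡ k * (q * (x * x))
    collect = solve-∀
    leaf : W (suc m) (suc r) start (suc m) ≡ q ^ suc m
    leaf = trans (cong (λ c → c * W (suc m) r fromParent (suc (suc m)) + 1 * W (suc m) r fromChild m)
                       (childCount-outer {suc m} ≤-refl))
                 (trans (+-identityʳ _)
                        (trans (cong (λ x → W (suc m) (suc (m + x)) fromChild m) (+-identityʳ m))
                               (ascending-longest (suc m) m (n<1+n m))))

  repunit : ℕ → ℕ
  repunit zero    = 0
  repunit (suc s) = 1 + q * repunit s

  repunit-geometric : ∀ s → p * repunit s + 1 ≡ q ^ s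
  repunit-geometric zero    = cong (_+ 1) (*-zeroʳ p)
  repunit-geometric (suc s) = trans (expand p (repunit s)) (cong (q *_) (repunit-geometric s))
    where
    expand : ∀ p g → p * (1 + suc p * g) + 1 ≡ suc p * (p * g + 1)
    expand = solve-∀

  total-odd : ∀ m s → total (m + s) (suc (2 * m)) ≡ 2 * k * q ^ (2 * m) * repunit s
  total-odd m zero    = trans (cong (λ N → total N (suc (2 * m))) (+-identityʳ m))
                              (trans (total-beyond m (2 * m) ≤-refl) (sym (*-zeroʳ (2 * k * q ^ (2 * m)))))
  total-odd m (suc s) = begin
    total (m + suc s) (suc (2 * m))
      ≡⟨ cong (λ N → total N (suc (2 * m))) (+-suc m s) ⟩
    total (suc (m + s)) (suc (2 * m))
      ≡⟨ total-step (m + s) (2 * m) (*-monoʳ-≤ 2 (m≤m+n m s)) ⟩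
    q * total (m + s) (suc (2 * m)) + 2 * k * q ^ (2 * m)
      ≡⟨ cong (λ x → q * x + 2 * k * q ^ (2 * m)) (total-odd m s) ⟩
    q * (2 * k * q ^ (2 * m) * repunit s) + 2 * k * q ^ (2 * m)
      ≡⟨ factor q (2 * k * q ^ (2 * m)) (repunit s) ⟩
    2 * k * q ^ (2 * m) * repunit (suc s) ∎
    where
    open ≡-Reasoning
    factor : ∀ q a g → q * (a * g) + a ≡ a * (1 + q * g)
    factor = solve-∀

  total-even : ∀ m s → total (suc m + s) (suc (suc (2 * m))) ≡ k * q ^ suc (2 * m) * (repunit (suc s) + repunit s)
  total-even m zero    = trans (cong (λ N → total N (suc (suc (2 * m)))) (+-identityʳ (suc m)))
                               (trans (total-diameter m) (unit q (k * q ^ suc (2 * m))))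
    where
    unit : ∀ q x → x ≡ x * ((1 + q * 0) + 0)
    unit = solve-∀
  total-even m (suc s) = begin
    total (suc m + suc s) (suc (suc (2 * m)))
      ≡⟨ cong (λ N → total N (suc (suc (2 * m)))) (+-suc (suc m) s) ⟩
    total (suc (suc m + s)) (suc (suc (2 * m)))
      ≡⟨ total-step (suc m + s) (suc (2 * m)) r≤2n ⟩
    q * total (suc m + s) (suc (suc (2 * m))) + 2 * k * q ^ suc (2 * m)
      ≡⟨ cong (λ x → q * x + 2 * k * q ^ suc (2 * m)) (total-even m s) ⟩
    q * (k * q ^ suc (2 * m) * (repunit (suc s) + repunit s)) + 2 * k * q ^ suc (2 * m)
      ≡⟨ factor q k (q ^ suc (2 * m)) (repunit s) ⟩
    k * q ^ suc (2 * m) * (repunit (suc (suc s)) + repunit (suc s)) ∎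
    where
    open ≡-Reasoning
    factor : ∀ q k x g → q * (k * x * ((1 + q * g) + g)) + 2 * k * x ≡ k * x * ((1 + q * (1 + q * g)) + (1 + q * g))
    factor = solve-∀
    r≤2n : suc (2 * m) ≤ 2 * (suc m + s)
    r≤2n = ≤-trans (≤-trans (n≤1+n _) (≤-reflexive (sym (2*suc m)))) (*-monoʳ-≤ 2 (m≤m+n (suc m) s))

  numPaths-from-total : ∀ n ℓ {x} → total n ℓ ≡ 2 * x → numPaths n k ℓ ≡ x
  numPaths-from-total n ℓ {x} total≡ = trans (cong (_/ 2) (trans (orientedPaths≡total n ℓ) total≡)) (half-double x)

  numPaths-odd : ∀ n m → m ≤ n → p * numPaths n k (2 * m + 1) ≡ k * q ^ m * (q ^ n ∸ q ^ m)
  numPaths-odd n m m≤n = begin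
    p * numPaths n k (2 * m + 1)
      ≡⟨ cong (p *_) (numPaths-from-total n (2 * m + 1) total≡) ⟩
    p * (k * q ^ (2 * m) * repunit s)
      ≡⟨ cong (λ x → p * (k * x * repunit s)) (^-double q m) ⟩
    p * (k * (q ^ m * q ^ m) * repunit s)
      ≡⟨ rearrange p k (q ^ m) (repunit s) ⟩
    k * q ^ m * (q ^ m * (p * repunit s))
      ≡⟨ cong (k * q ^ m *_) (sym (m+n∸n≡m (q ^ m * (p * repunit s)) (q ^ m))) ⟩
    k * q ^ m * (q ^ m * (p * repunit s) + q ^ m ∸ q ^ m)
      ≡⟨ cong (λ x → k * q ^ m * (x ∸ q ^ m))
              (trans (factor (q ^ m) (p * repunit s)) (cong (q ^ m *_) (repunit-geometric s))) ⟩
    k * q ^ m * (q ^ m * q ^ s ∸ q ^ m)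
      ≡⟨ cong (λ x → k * q ^ m * (x ∸ q ^ m)) (trans (sym (^-distribˡ-+-* q m s)) (cong (q ^_) (m+[n∸m]≡n m≤n))) ⟩
    k * q ^ m * (q ^ n ∸ q ^ m) ∎
    where
    open ≡-Reasoning
    s = n ∸ m
    double : ∀ a b c → 2 * a * b * c ≡ 2 * (a * b * c)
    double = solve-∀
    total≡ : total n (2 * m + 1) ≡ 2 * (k * q ^ (2 * m) * repunit s)
    total≡ = begin
      total n (2 * m + 1)             ≡⟨ cong₂ total (sym (m+[n∸m]≡n m≤n)) (+-comm (2 * m) 1) ⟩
      total (m + s) (suc (2 * m))     ≡⟨ total-odd m s ⟩
      2 * k * q ^ (2 * m) * repunit s ≡⟨ double k (q ^ (2 * m)) (repunit s) ⟩
      2 * (k * q ^ (2 * m) * repunit s) ∎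
    rearrange : ∀ p k x g → p * (k * (x * x) * g) ≡ k * x * (x * (p * g))
    rearrange = solve-∀
    factor : ∀ x y → x * y + x ≡ x * (y + 1)
    factor = solve-∀

  k*q^s≡repunits : ∀ s → k * q ^ s ≡ p * (repunit (suc s) + repunit s) + 2
  k*q^s≡repunits s = begin
    q ^ s + q * q ^ s
      ≡⟨ cong₂ _+_ (sym (repunit-geometric s)) (sym (repunit-geometric (suc s))) ⟩
    (p * repunit s + 1) + (p * repunit (suc s) + 1)
      ≡⟨ collect p (repunit s) (repunit (suc s)) ⟩
    p * (repunit (suc s) + repunit s) + 2 ∎
    where
    open ≡-Reasoning
    collect : ∀ p a b → (p * a + 1) + (p * b + 1) ≡ p * (b + a) + 2
    collect = solve-∀

  -- k·q = (q + 1)·q is even, which makes the halving in numPaths exact.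
  total-even-halved : ∀ m s →
    total (suc m + s) (2 * suc m) ≡ 2 * (triangle q * q ^ (2 * m) * (repunit (suc s) + repunit s))
  total-even-halved m s = begin
    total (suc m + s) (2 * suc m)         ≡⟨ cong (total (suc m + s)) (2*suc m) ⟩
    total (suc m + s) (suc (suc (2 * m))) ≡⟨ total-even m s ⟩
    k * (q * x) * H                       ≡⟨ pair q x H ⟩
    k * q * x * H                         ≡⟨ cong (λ t → t * x * H) (triangle-double q) ⟩
    2 * triangle q * x * H                ≡⟨ double (triangle q) x H ⟩
    2 * (triangle q * x * H) ∎
    where
    open ≡-Reasoning
    x = q ^ (2 * m)
    H = repunit (suc s) + repunit s
    pair : ∀ q x h → suc q * (q * x) * h ≡ suc q * q * x * h
    pair = solve-∀
    double : ∀ t x h → 2 * t * x * h ≡ 2 * (t * x * h)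
    double = solve-∀

  numPaths-even : ∀ n m → suc m ≤ n →
    2 * p * numPaths n k (2 * suc m) ≡ k * q ^ (2 * suc m ∸ 1) * (k * q ^ (n ∸ suc m) ∸ 2)
  numPaths-even n m m<n = begin
    2 * p * numPaths n k (2 * suc m)
      ≡⟨ cong (2 * p *_) (numPaths-from-total n (2 * suc m)
                            (trans (cong (λ N → total N (2 * suc m)) (sym (m+[n∸m]≡n m<n))) (total-even-halved m s))) ⟩
    2 * p * (triangle q * x * H)
      ≡⟨ double-inside p (triangle q) x H ⟩
    p * (2 * triangle q) * x * H
      ≡⟨ cong (λ t → p * t * x * H) (sym (triangle-double q)) ⟩
    p * (k * q) * x * H
      ≡⟨ rearrange p k q x H ⟩
    k * q ^ suc (2 * m) * (p * H)
      ≡⟨ cong₂ (λ e y → k * q ^ e * y) (cong (_∸ 1) (sym (2*suc m)))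
               (sym (trans (cong (_∸ 2) (k*q^s≡repunits s)) (m+n∸n≡m (p * H) 2))) ⟩
    k * q ^ (2 * suc m ∸ 1) * (k * q ^ s ∸ 2) ∎
    where
    open ≡-Reasoning
    s = n ∸ suc m
    x = q ^ (2 * m)
    H = repunit (suc s) + repunit s
    double-inside : ∀ p t x h → 2 * p * (t * x * h) ≡ p * (2 * t) * x * h
    double-inside = solve-∀
    rearrange : ∀ p k q x h → p * (k * q) * x * h ≡ k * (q * x) * (p * h)
    rearrange = solve-∀

corollary1 : (n k ℓ : ℕ) → 1 ≤ n → 3 ≤ k → 1 ≤ ℓ → ℓ ≤ 2 * n →
    ((m : ℕ) → ℓ ≡ 2 * m →
      2 * (k ∸ 2) * numPaths n k ℓ ≡ k * (k ∸ 1) ^ (ℓ ∸ 1) * (k * (k ∸ 1) ^ (n ∸ m) ∸ 2))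
    × ((m : ℕ) → ℓ ≡ 2 * m + 1 →
      (k ∸ 2) * numPaths n k ℓ ≡ k * (k ∸ 1) ^ m * ((k ∸ 1) ^ n ∸ (k ∸ 1) ^ m))
corollary1 n (suc (suc (suc p))) ℓ _ (s≤s (s≤s (s≤s _))) 1≤ℓ ℓ≤2n = even , odd
  where
  open Counting (suc p)
  even : (m : ℕ) → ℓ ≡ 2 * m → 2 * suc p * numPaths n k ℓ ≡ k * q ^ (ℓ ∸ 1) * (k * q ^ (n ∸ m) ∸ 2)
  even zero    ℓ≡0  = ⊥-elim (<⇒≢ 1≤ℓ (sym ℓ≡0))
  even (suc m) refl = numPaths-even n m (*-cancelˡ-≤ 2 ℓ≤2n)
  odd : (m : ℕ) → ℓ ≡ 2 * m + 1 → suc p * numPaths n k ℓ ≡ k * q ^ m * (q ^ n ∸ q ^ m)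
  odd m refl = numPaths-odd n m (*-cancelˡ-≤ 2 (≤-trans (m≤m+n (2 * m) 1) ℓ≤2n))
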